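{- Let $n$ be a multiple of $6$ and let $C_n$ be the $n$-cycle. For every symmetric strategy for rendezvous on $C_n$ and every $T\ge0$, \[ \Pr[\text{no rendezvous in the first } T \text{ steps}]\ge \frac12\,3^{ -6T/n}, \] where the players are counted as having rendezvoused at a step if they are at the same vertex at the same time, or if they traverse the same edge in opposite directions during the same step.
   Context: Rendezvous on $C_n$ (vertices $\mathbb{Z}_n$, $i$ adjacent to $i\pm1$): each player labels the vertices privately, and the two labelings differ by an automorphism $\pi$ chosen uniformly at random from $\mathrm{Aut}(C_n)$, the dihedral group (maps $x\mapsto x+s$ and $x\mapsto -x+s$ mod $n$). A walk of length $T$ is a sequence $(v_0,\dots,v_T)$ with $v_{t+1}\in\{v_t-1,v_t,v_t+1\}$ mod $n$, including a starting vertex chosen by the player. A symmetric strategy is a distribution over such walks from which both players sample independently, independently of $\pi$.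
   Formalization: Each symmetric strategy is a distribution over walks whose probabilities are rational. -}

module Defs where

open import Data.Nat as ℕ using (ℕ; zero; suc; NonZero)
open import Data.Nat.DivMod using (_%_; m%n<n)
open import Data.Fin as Fin using (Fin; toℕ; fromℕ<)
open import Data.Vec using (Vec; _∷_; []; lookup)
open import Data.Bool using (Bool; true; false; if_then_else_; _∧_; _∨_; not)
open import Data.List using (List; []; _∷_; map; sum; foldr; allFin; filter; length)
open import Data.List.Relation.Unary.All using (All)
open import Data.Product using (Σ; _×_; _,_; proj₁; proj₂)
open import Data.Sum using (_⊎_)
open import Data.Integer using (+_)
open import Relation.Binary.PropositionalEquality using (_≡_)
open import Data.Rational as ℚ using (ℚ; 0ℚ; 1ℚ; _/_)

module _ (n : ℕ) .{{_ : NonZero n}} where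

  mod : ℕ → Fin n
  mod a = fromℕ< (m%n<n a n)

  _⊕_ : Fin n → Fin n → Fin n
  a ⊕ b = mod (toℕ a ℕ.+ toℕ b)

  ⊝ : Fin n → Fin n
  ⊝ a = mod (n ℕ.∸ toℕ a)

  one : Fin n
  one = mod 1

  Step : Fin n → Fin n → Set
  Step v v' = (v' ≡ v ⊕ one) ⊎ (v' ≡ v) ⊎ (v' ≡ v ⊕ ⊝ one)

  ValidWalk : {k : ℕ} → Vec (Fin n) (suc k) → Set
  ValidWalk (v ∷ [])          = Data.Unit.⊤ where import Data.Unit
  ValidWalk (v ∷ v' ∷ vs)     = Step v v' × ValidWalk (v' ∷ vs)

  -- A walk of length T: (v_0, …, v_T), starting vertex included.
  Walk : ℕ → Set
  Walk T = Σ (Vec (Fin n) (suc T)) ValidWalk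

  -- Automorphisms of C_n (dihedral group, 2n elements):
  -- (s , false) ↦ x ↦ x + s ;  (s , true) ↦ x ↦ -x + s.
  Aut : Set
  Aut = Fin n × Bool

  allAut : List Aut
  allAut = Data.List.cartesianProduct (allFin n) (true ∷ false ∷ [])
    where import Data.List

  applyAut : Aut → Fin n → Fin n
  applyAut (s , false) x = x ⊕ s
  applyAut (s , true)  x = ⊝ x ⊕ s

  mapVec : {k : ℕ} → (Fin n → Fin n) → Vec (Fin n) k → Vec (Fin n) k
  mapVec f []       = []
  mapVec f (x ∷ xs) = f x ∷ mapVec f xs

  eqV : Fin n → Fin n → Bool
  eqV a b = Relation.Nullary.Decidable.⌊ a Fin.≟ b ⌋
    where import Relation.Nullary.Decidable

  meets : {k : ℕ} → Vec (Fin n) (suc k) → Vec (Fin n) (suc k) → Bool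
  meets (v ∷ [])      (u ∷ [])      = eqV v u
  meets (v ∷ v' ∷ vs) (u ∷ u' ∷ us) =
    eqV v u ∨ (eqV v u' ∧ eqV v' u) ∨ meets (v' ∷ vs) (u' ∷ us)

  -- Number of automorphisms π for which the walks w (player 1) and
  -- π ∘ w' (player 2's walk, expressed in player 1's labeling) do NOT
  -- rendezvous in the first T steps.
  noMeetCount : {T : ℕ} → Walk T → Walk T → ℕ
  noMeetCount (w , _) (w' , _) =
    length (filter (λ π → Data.Bool.T? (not (meets w (mapVec (applyAut π) w')))) allAut)
    where import Data.Bool

  sumℚ : List ℚ → ℚ
  sumℚ = foldr ℚ._+_ 0ℚ

  -- A symmetric strategy: a (finitely supported) probability distribution
  -- over walks of length T, given as a list of (walk , probability) pairs
  -- with nonnegative weights summing to 1.  (Repeated walks allowed; their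
  -- weights add.)
  record Strategy (T : ℕ) : Set where
    field
      support : List (Walk T × ℚ)
      nonneg  : All (λ p → 0ℚ ℚ.≤ proj₂ p) support
      total   : sumℚ (map proj₂ support) ≡ 1ℚ

  -- Pr[no rendezvous in first T steps], both players sampling independently
  -- from the strategy, π uniform on Aut(C_n) (|Aut| = 2n).
  probNoRendezvous : {T : ℕ} → Strategy T → ℚ
  probNoRendezvous {T} σ =
    sumℚ (map (λ a → sumℚ (map (λ b →
        proj₂ a ℚ.* proj₂ b ℚ.* ((+ noMeetCount (proj₁ a) (proj₁ b)) / (2 ℕ.* n)))
      S)) S)
    where
    S = Strategy.support σ
    instance
      nz2n : NonZero (2 ℕ.* n)
      nz2n = Data.Nat.Properties.m*n≢0 2 n where import Data.Nat.Properties

_^ℚ_ : ℚ → ℕ → ℚ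
q ^ℚ zero  = 1ℚ
q ^ℚ suc k = q ℚ.* (q ^ℚ k)

{-# OPTIONS --safe #-}

-- Lift both walks to 1-Lipschitz integer paths F and G. Under the automorphism x ↦ ±x + s the
-- players cannot meet while the displacement F ∓ G − s stays strictly between two consecutive
-- multiples of n; so if F ∓ G stays in a window of w integers up to time T, at least n − w of the
-- n shifts s avoid rendezvous.
--
-- Windows come from coarse-graining time. With m = n/6, q = ⌊T/m⌋ and block times
-- τ i = ⌊m/2⌋ + i·m, the itinerary of a phase ρ < m is the sequence of moves (−1, 0 or +1) of the
-- cell ⌊(ρ + F (τ i) − F (τ 0))/m⌋ for i ≤ q. When phases of F and of G share an itinerary, all
-- such coincidences have offsets ρ' − ρ in an interval of K integers while F − G stays in a window
-- of 4m − K integers; as 3·min(K, m) ≤ 2m + K, there are at most m/3 coinciding phase pairs per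
-- good shift.
--
-- Averaging over the strategy, the weighted number of coincidences is Σ_δ R(δ)² for the itinerary
-- profile R, whose total mass is 2m, and Cauchy–Schwarz over the 3^q itineraries bounds it below
-- by 4m²/3^q. Hence 2·P·3^q ≥ 1, which is the claim because q·m ≤ T.

module Submission where

module Integers where

  open import Data.Empty using (⊥)
  open import Data.Integer as ℤ using (ℤ; +_; +[1+_]; -[1+_]; 0ℤ; 1ℤ; _+_; _-_; _*_; -_; _≤_; +≤+)
  import Data.Integer.Properties as ℤP
  open import Data.Integer.Tactic.RingSolver using (solve-∀)
  open import Data.Nat as ℕ using (ℕ; zero; suc; z≤n)
  import Data.Nat.Properties as ℕP
  open import Data.Product using (Σ; _×_; _,_; proj₁)
  open import Data.Sum using (_⊎_; inj₁; inj₂; [_,_]′)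
  open import Function using (_∘_)
  open import Relation.Binary.PropositionalEquality
  open import Relation.Nullary using (¬_)

  infix 4 _∈[_,_]

  _∈[_,_] : ℤ → ℤ → ℤ → Set
  x ∈[ a , b ] = a ≤ x × x ≤ b

  ∈-resp : ∀ {x x' a a' b b'} → x ≡ x' → a ≡ a' → b ≡ b' → x ∈[ a , b ] → x' ∈[ a' , b' ]
  ∈-resp refl refl refl x∈ = x∈

  ∈-+ : ∀ {x y a b c d} → x ∈[ a , b ] → y ∈[ c , d ] → x + y ∈[ a + c , b + d ]
  ∈-+ (a≤x , x≤b) (c≤y , y≤d) = ℤP.+-mono-≤ a≤x c≤y , ℤP.+-mono-≤ x≤b y≤d

  ∈-neg : ∀ {x a b} → x ∈[ a , b ] → - x ∈[ - b , - a ]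
  ∈-neg (a≤x , x≤b) = ℤP.neg-mono-≤ x≤b , ℤP.neg-mono-≤ a≤x

  InWindow : ℕ → (ℕ → ℤ) → ℤ → ℕ → Set
  InWindow T x P w = ∀ t → t ℕ.≤ T → x t ∈[ P , P + + w - 1ℤ ]

  window-negate : ∀ {T x y P w} → (∀ t → y t ≡ - x t) → InWindow T x P w → InWindow T y (- (P + + w - 1ℤ)) w
  window-negate {P = P} {w} y≡-x window t t≤T = ∈-resp (sym (y≡-x t)) refl (reopen P (+ w)) (∈-neg (window t t≤T))
    where
    reopen : ∀ P w → - P ≡ - (P + w - 1ℤ) + w - 1ℤ
    reopen = solve-∀

  -- Linear facts over ℤ are proved by certificates: each hypothesis a ≤ b is
  -- turned into 0 ≤ b - a, these are added, and solve-∀ identifies the sum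
  -- with the goal (or with a negative constant, for a contradiction).

  0≤+ : ∀ {x y} → 0ℤ ≤ x → 0ℤ ≤ y → 0ℤ ≤ x + y
  0≤+ = ℤP.+-mono-≤

  0≤* : ∀ {x y} → 0ℤ ≤ x → 0ℤ ≤ y → 0ℤ ≤ x * y
  0≤* {+ a} {+ b} _ _ = subst (0ℤ ≤_) (ℤP.pos-* a b) (+≤+ z≤n)

  slack : ∀ {a b} → a ≤ b → 0ℤ ≤ b - a
  slack = ℤP.i≤j⇒0≤j-i

  0≤ℕ : ∀ k → 0ℤ ≤ + k
  0≤ℕ k = +≤+ z≤n

  ≤-certified : ∀ {x a b} → 0ℤ ≤ x → x ≡ b - a → a ≤ b
  ≤-certified h refl = ℤP.0≤i-j⇒j≤i h

  certified-absurd : ∀ {x} k → 0ℤ ≤ x → x ≡ - + suc k → ⊥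
  certified-absurd k h refl with h
  ... | ()

  <⇒1+≤ : ∀ {r m} → r ℕ.< m → 1ℤ + + r ≤ + m
  <⇒1+≤ r<m = ℤP.i<j⇒suc[i]≤j (ℤ.+<+ r<m)

  multiple-≤0⊎≥ : ∀ k n → k * + n ≤ 0ℤ ⊎ + n ≤ k * + n
  multiple-≤0⊎≥ (+ 0)      n = inj₁ (+≤+ z≤n)
  multiple-≤0⊎≥ +[1+ j ]   n = inj₂ (subst (+ n ≤_) (ℤP.pos-* (suc j) n) (+≤+ (ℕP.m≤m+n n (j ℕ.* n))))
  multiple-≤0⊎≥ -[1+ j ]   n = inj₁ (subst (_≤ 0ℤ)
    (trans (cong -_ (ℤP.pos-* (suc j) n)) (ℤP.neg-distribˡ-* (+ suc j) (+ n))) (ℤP.neg-mono-≤ (+≤+ z≤n)))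

  record Lipschitz (F : ℕ → ℤ) : Set where
    constructor lipschitz
    field step : ∀ t → F (suc t) - F t ∈[ - 1ℤ , 1ℤ ]

  open Lipschitz public

  Lipschitz-suc : ∀ {F} → Lipschitz F → Lipschitz (F ∘ suc)
  Lipschitz-suc lip = lipschitz (step lip ∘ suc)

  negate : (ℕ → ℤ) → ℕ → ℤ
  negate F t = - F t

  Lipschitz-negate : ∀ {F} → Lipschitz F → Lipschitz (negate F)
  Lipschitz-negate {F} lip = lipschitz λ t → ∈-resp (flip (F (suc t)) (F t)) refl refl (∈-neg (step lip t))
    where
    flip : ∀ a b → - (a - b) ≡ - a - - b
    flip = solve-∀

  lipschitz-gap : ∀ {F} → Lipschitz F → ∀ s d → F (d ℕ.+ s) - F s ∈[ - + d , + d ]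
  lipschitz-gap {F} lip s zero    = ∈-resp (sym (ℤP.+-inverseʳ (F s))) refl refl (ℤP.≤-refl , ℤP.≤-refl)
  lipschitz-gap {F} lip s (suc d) =
    ∈-resp (telescope (F (suc d ℕ.+ s)) (F (d ℕ.+ s)) (F s)) (neg-distrib (+ d)) refl
           (∈-+ (step lip (d ℕ.+ s)) (lipschitz-gap lip s d))
    where
    telescope : ∀ a b c → (a - b) + (b - c) ≡ a - c
    telescope = solve-∀
    neg-distrib : ∀ D → - 1ℤ + - D ≡ - (1ℤ + D)
    neg-distrib = solve-∀

  lipschitz-between : ∀ {F} → Lipschitz F → ∀ {s t} → s ℕ.≤ t → F t - F s ∈[ - (+ t - + s) , + t - + s ]
  lipschitz-between {F} lip {s} {t} s≤t =
    ∈-resp (cong (λ u → F u - F s) (ℕP.m∸n+n≡m s≤t)) (cong -_ gap≡) gap≡ (lipschitz-gap lip s (t ℕ.∸ s))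
    where
    gap≡ : + (t ℕ.∸ s) ≡ + t - + s
    gap≡ = trans (sym (ℤP.⊖-≥ s≤t)) (sym (ℤP.m-n≡m⊖n t s))

  quotient-step : ∀ {x y r r' a b M} → x ≡ r + a * M → y ≡ r' + b * M →
    r ∈[ 0ℤ , M - 1ℤ ] → r' ∈[ 0ℤ , M - 1ℤ ] → y - x ∈[ - M , M ] → b - a ∈[ - 1ℤ , 1ℤ ]
  quotient-step {r = r} {r'} {a} {b} {M} refl refl (0≤r , r<M) (0≤r' , r'<M) (lo , hi) =
    ℤP.≮⇒≥ no-drop , ℤP.≮⇒≥ no-jump
    where
    0≤M : 0ℤ ≤ M
    0≤M = ≤-certified (0≤+ (0≤+ (slack 0≤r) (slack r<M)) (0≤ℕ 1)) (positive r M)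
      where
      positive : ∀ r M → ((r - 0ℤ) + ((M - 1ℤ) - r)) + 1ℤ ≡ M - 0ℤ
      positive = solve-∀
    no-jump : ¬ (1ℤ ℤ.< b - a)
    no-jump 1<d = certified-absurd 0
      (0≤+ (0≤+ (0≤* (slack (ℤP.i<j⇒suc[i]≤j 1<d)) 0≤M) (slack hi)) (0≤+ (slack 0≤r') (slack r<M)))
      (jump r r' a b M)
      where
      jump : ∀ r r' a b M →
        (((b - a) - (1ℤ + 1ℤ)) * M + (M - ((r' + b * M) - (r + a * M)))) + ((r' - 0ℤ) + ((M - 1ℤ) - r)) ≡ - 1ℤ
      jump = solve-∀
    no-drop : ¬ (b - a ℤ.< - 1ℤ)
    no-drop d<-1 = certified-absurd 0
      (0≤+ (0≤+ (0≤* (slack (ℤP.i<j⇒suc[i]≤j d<-1)) 0≤M) (slack lo)) (0≤+ (slack 0≤r) (slack r'<M)))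
      (drop r r' a b M)
      where
      drop : ∀ r r' a b M →
        (((- 1ℤ) - (1ℤ + (b - a))) * M + (((r' + b * M) - (r + a * M)) - - M)) + ((r - 0ℤ) + ((M - 1ℤ) - r')) ≡ - 1ℤ
      drop = solve-∀

  same-quotient : ∀ {x y r r' a M} → x ≡ r + a * M → y ≡ r' + a * M →
    r ∈[ 0ℤ , M - 1ℤ ] → r' ∈[ 0ℤ , M - 1ℤ ] → x - y ∈[ - (M - 1ℤ) , M - 1ℤ ]
  same-quotient {r = r} {r'} {a} {M} refl refl r∈ r'∈ =
    ∈-resp (difference r r' a M) (lower M) (upper M) (∈-+ r∈ (∈-neg r'∈))
    where
    difference : ∀ r r' a M → r + - r' ≡ (r + a * M) - (r' + a * M)
    difference = solve-∀
    lower : ∀ M → 0ℤ + - (M - 1ℤ) ≡ - (M - 1ℤ)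
    lower = solve-∀
    upper : ∀ M → (M - 1ℤ) + - 0ℤ ≡ M - 1ℤ
    upper = solve-∀

  argmax : ∀ (f : ℕ → ℤ) k → Σ ℕ λ j → j ℕ.≤ k × (∀ i → i ℕ.≤ k → f i ≤ f j)
  argmax f zero = 0 , z≤n , λ { .0 z≤n → ℤP.≤-refl }
  argmax f (suc k) with argmax f k | ℤP.≤-total (f (suc k)) (f (proj₁ (argmax f k)))
  ... | j , j≤k , max | inj₁ fk≤fj =
    j , ℕP.m≤n⇒m≤1+n j≤k , λ i i≤ → [ max i ∘ ℕP.m<1+n⇒m≤n , (λ { refl → fk≤fj }) ]′ (ℕP.m≤n⇒m<n∨m≡n i≤)
  ... | j , j≤k , max | inj₂ fj≤fk =
    suc k , ℕP.≤-refl , λ i i≤ → [ (λ i<1+k → ℤP.≤-trans (max i (ℕP.m<1+n⇒m≤n i<1+k)) fj≤fk) , (λ { refl → ℤP.≤-refl }) ]′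
                                  (ℕP.m≤n⇒m<n∨m≡n i≤)

module Counting where

  open Integers
  open import Data.Bool using (Bool; true; false; _∧_; T; T?)
  open import Data.Empty using (⊥; ⊥-elim)
  open import Data.Fin as Fin using (Fin; toℕ)
  open import Data.Integer using (ℤ; +_; 0ℤ; 1ℤ; _+_; _-_; -_; _≤_)
  import Data.Integer.Properties as ℤP
  open import Data.Integer.Tactic.RingSolver using (solve-∀)
  open import Data.List using (List; _∷_; []; filter; length; tabulate; cartesianProduct)
  open import Data.Nat as ℕ using (ℕ; zero; suc; z≤n; s≤s; _<ᵇ_)
  import Data.Nat.Properties as ℕP
  open import Algebra.Properties.CommutativeMonoid.Sum ℕP.+-0-commutativeMonoid using (sum; sum-syntax)
  import Data.Nat.Tactic.RingSolver as ℕ-Solver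
  open import Data.Product using (_×_; _,_; proj₁; proj₂)
  open import Data.Unit using (tt)
  open import Function using (_∘_)
  open import Relation.Binary.PropositionalEquality
  open import Relation.Nullary using (Dec; ¬_; does; yes; no)
  open import Relation.Nullary.Decidable using (isYes; isYes≗does; dec-false)

  isYes-false : ∀ {A : Set} (a? : Dec A) → ¬ A → isYes a? ≡ false
  isYes-false a? ¬a = trans (isYes≗does a?) (dec-false a? ¬a)

  ∧-false : ∀ {A B : Set} (a? : Dec A) (b? : Dec B) → (A → B → ⊥) → (isYes a? ∧ isYes b?) ≡ false
  ∧-false (no _)  _  _ = refl
  ∧-false (yes a) b? f = isYes-false b? (f a)

  does-true : ∀ {A : Set} (a? : Dec A) → T (does a?) → A
  does-true (yes a) _ = a

  𝟙 : Bool → ℕ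
  𝟙 true  = 1
  𝟙 false = 0

  count : ∀ {A : Set} → (A → Bool) → List A → ℕ
  count p xs = length (filter (λ x → T? (p x)) xs)

  count-∷ : ∀ {A : Set} (p : A → Bool) x xs → count p (x ∷ xs) ≡ 𝟙 (p x) ℕ.+ count p xs
  count-∷ p x xs with p x
  ... | true  = refl
  ... | false = refl

  count-pairs : ∀ {A : Set} {N} (f : Fin N → A) (p : A × Bool → Bool) →
    count p (cartesianProduct (tabulate f) (true ∷ false ∷ List.[])) ≡
    ∑[ i < N ] 𝟙 (p (f i , true)) ℕ.+ ∑[ i < N ] 𝟙 (p (f i , false))
  count-pairs {N = zero}  f p = refl
  count-pairs {N = suc N} f p = begin
    count p ((x , true) ∷ (x , false) ∷ rest)       ≡⟨ count-∷ p _ _ ⟩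
    a ℕ.+ count p ((x , false) ∷ rest)               ≡⟨ cong (a ℕ.+_) (count-∷ p _ _) ⟩
    a ℕ.+ (b ℕ.+ count p rest)                       ≡⟨ cong (λ r → a ℕ.+ (b ℕ.+ r)) (count-pairs (f ∘ Fin.suc) p) ⟩
    a ℕ.+ (b ℕ.+ (St ℕ.+ Sf))                        ≡⟨ interchange a b St Sf ⟩
    (a ℕ.+ St) ℕ.+ (b ℕ.+ Sf)                        ∎
    where
    open ≡-Reasoning
    x = f Fin.zero
    a = 𝟙 (p (x , true))
    b = 𝟙 (p (x , false))
    rest = cartesianProduct (tabulate (f ∘ Fin.suc)) (true ∷ false ∷ List.[])
    St = ∑[ i < N ] 𝟙 (p (f (Fin.suc i) , true))
    Sf = ∑[ i < N ] 𝟙 (p (f (Fin.suc i) , false))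
    interchange : ∀ a b c d → a ℕ.+ (b ℕ.+ (c ℕ.+ d)) ≡ (a ℕ.+ c) ℕ.+ (b ℕ.+ d)
    interchange = ℕ-Solver.solve-∀

  sum-mono : ∀ {N} {f g : Fin N → ℕ} → (∀ i → f i ℕ.≤ g i) → sum f ℕ.≤ sum g
  sum-mono {zero}  f≤g = z≤n
  sum-mono {suc N} f≤g = ℕP.+-mono-≤ (f≤g Fin.zero) (sum-mono (f≤g ∘ Fin.suc))

  sum-const : ∀ N c → ∑[ i < N ] c ≡ N ℕ.* c
  sum-const zero    c = refl
  sum-const (suc N) c = cong (c ℕ.+_) (sum-const N c)

  sum-≤-const : ∀ {N k} {f : Fin N → ℕ} → (∀ i → f i ℕ.≤ k) → sum f ℕ.≤ N ℕ.* k
  sum-≤-const {N} {k} f≤k = ℕP.≤-trans (sum-mono f≤k) (ℕP.≤-reflexive (sum-const N k))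

  count-≤ : ∀ {N} (b : Fin N → Bool) → ∑[ i < N ] 𝟙 (b i) ℕ.≤ N
  count-≤ {N} b = ℕP.≤-trans (sum-mono {g = λ _ → 1} (λ i → indicator≤1 (b i)))
                             (ℕP.≤-reflexive (trans (sum-const N 1) (ℕP.*-identityʳ N)))
    where
    indicator≤1 : ∀ x → 𝟙 x ℕ.≤ 1
    indicator≤1 true  = ℕP.≤-refl
    indicator≤1 false = z≤n

  count-below : ∀ {N w} → w ℕ.≤ N → ∑[ i < N ] 𝟙 (toℕ i <ᵇ w) ≡ w
  count-below {zero}  z≤n       = refl
  count-below {suc N} {zero} _  = trans (sum-const (suc N) 0) (ℕP.*-zeroʳ N)
  count-below {suc N} {suc w} (s≤s w≤N) = cong suc (count-below w≤N)

  count-interval : ∀ {N} (b : Fin N → Bool) (L : ℤ) (K : ℕ) →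
    (∀ i → T (b i) → + toℕ i ∈[ L , L + + K - 1ℤ ]) → ∑[ i < N ] 𝟙 (b i) ℕ.≤ K
  count-interval {zero}  _ _ _ _ = z≤n
  count-interval {suc N} b L K inside with b Fin.zero in b₀
  count-interval {suc N} b L K inside | false = count-interval (b ∘ Fin.suc) (L - 1ℤ) K
    (λ i bi → ∈-resp (shift (+ toℕ i)) (lower L) (upper L (+ K))
                     (∈-+ (inside (Fin.suc i) bi) (ℤP.≤-refl { - 1ℤ} , ℤP.≤-refl)))
    where
    shift : ∀ x → (1ℤ + x) + - 1ℤ ≡ x
    shift = solve-∀
    lower : ∀ L → L + - 1ℤ ≡ L - 1ℤ
    lower = solve-∀
    upper : ∀ L K → (L + K - 1ℤ) + - 1ℤ ≡ (L - 1ℤ) + K - 1ℤ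
    upper = solve-∀
  count-interval {suc N} b L zero inside | true =
    ⊥-elim (certified-absurd 0 (0≤+ (slack (proj₁ first)) (slack (proj₂ first))) (empty L))
    where
    first = inside Fin.zero (subst T (sym b₀) tt)
    empty : ∀ L → (0ℤ - L) + ((L + + 0 - 1ℤ) - 0ℤ) ≡ - 1ℤ
    empty = solve-∀
  count-interval {suc N} b L (suc K) inside | true = s≤s (count-interval (b ∘ Fin.suc) 0ℤ K
    (λ i bi → 0≤ℕ (toℕ i) ,
              ≤-certified (0≤+ (slack (proj₂ (inside (Fin.suc i) bi))) (slack (proj₁ first))) (tighten L (+ toℕ i) (+ K))))
    where
    first = inside Fin.zero (subst T (sym b₀) tt)
    tighten : ∀ L x K → ((L + (1ℤ + K) - 1ℤ) - (1ℤ + x)) + (0ℤ - L) ≡ (0ℤ + K - 1ℤ) - x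
    tighten = solve-∀

module Walks where

  open import Defs
  open Integers
  open Counting
  open import Data.Bool using (true; false; not; _∨_; T)
  open import Data.Empty using (⊥; ⊥-elim)
  open import Data.Fin as Fin using (Fin; toℕ; fromℕ<)
  import Data.Fin.Properties as FinP
  open import Data.Fin.Permutation using (permutation)
  open import Data.Integer as ℤ using (ℤ; +_; +[1+_]; -[1+_]; 0ℤ; 1ℤ; _+_; _-_; _*_; -_; _≤_; +≤+)
  import Data.Integer.Properties as ℤP
  open import Data.Integer.DivMod using (_%ℕ_; _/ℕ_; n%ℕd<d; a≡a%ℕn+[a/ℕn]*n)
  open import Data.Integer.Tactic.RingSolver using (solve-∀)
  open import Data.Nat as ℕ using (ℕ; zero; suc; NonZero; z≤n; s≤s; _<ᵇ_)
  import Data.Nat.DivMod as ℕD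
  import Data.Nat.Properties as ℕP
  open import Algebra.Properties.CommutativeMonoid.Sum ℕP.+-0-commutativeMonoid using (sum-syntax; ∑-distrib-+; sum-permute)
  open import Data.Product using (Σ; _×_; _,_)
  open import Data.Sum using (inj₁; inj₂)
  open import Data.Vec using (Vec; _∷_; []; head)
  open import Function using (_∘_)
  open import Relation.Binary.PropositionalEquality hiding ([_])

  shifted-separation : ∀ {f h S P r Q N W} → S ≡ P + (r + Q) → f - h ∈[ P , P + W - 1ℤ ] → W ≤ r → 1ℤ + r ≤ N →
                       f - (h + S - (Q + N)) ∈[ 1ℤ , N - 1ℤ ]
  shifted-separation {f} {h} {_} {P} {r} {Q} {N} {W} refl (lo , hi) W≤r r<N =
    ≤-certified (0≤+ (slack lo) (slack r<N)) (lower f h P r Q N) ,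
    ≤-certified (0≤+ (slack hi) (slack W≤r)) (upper f h P r Q N W)
    where
    lower : ∀ f h P r Q N → (f - h - P) + (N - (1ℤ + r)) ≡ f - (h + (P + (r + Q)) - (Q + N)) - 1ℤ
    lower = solve-∀
    upper : ∀ f h P r Q N W → (P + W - 1ℤ - (f - h)) + (r - W) ≡ N - 1ℤ - (f - (h + (P + (r + Q)) - (Q + N)))
    upper = solve-∀

  module Cycle (n : ℕ) .{{_ : NonZero n}} where

    [_] : ℤ → Fin n
    [ z ] = fromℕ< (n%ℕd<d z n)

    toℕ-[] : ∀ z → toℕ [ z ] ≡ z %ℕ n
    toℕ-[] z = FinP.toℕ-fromℕ< (n%ℕd<d z n)

    private
      no-large-residue : ∀ {r r'} j → r ℕ.< n → + r ≡ + r' + +[1+ j ] * + n → ⊥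
      no-large-residue {r} {r'} j r<n eq =
        ℕP.<⇒≱ r<n (subst (n ℕ.≤_) (sym r≡) (ℕP.≤-trans (ℕP.m≤m+n n (j ℕ.* n)) (ℕP.m≤n+m _ r')))
        where
        r≡ : r ≡ r' ℕ.+ suc j ℕ.* n
        r≡ = ℤP.+-injective (trans eq (trans (cong (λ z → + r' + z) (sym (ℤP.pos-* (suc j) n))) (sym (ℤP.pos-+ r' _))))

    residue-unique : ∀ {r r'} k → r ℕ.< n → r' ℕ.< n → + r ≡ + r' + k * + n → r ≡ r'
    residue-unique (+ 0)              _   _    eq = ℤP.+-injective (trans eq (ℤP.+-identityʳ _))
    residue-unique +[1+ j ]           r<n _    eq = ⊥-elim (no-large-residue j r<n eq)
    residue-unique {r} {r'} -[1+ j ]  _   r'<n eq =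
      ⊥-elim (no-large-residue j r'<n (trans (shift (+ r') (+ suc j) (+ n)) (cong (_+ _) (sym eq))))
      where
      shift : ∀ a k m → a ≡ (a + (- k) * m) + k * m
      shift = solve-∀

    decompose : ∀ z → z ≡ + toℕ [ z ] + (z /ℕ n) * + n
    decompose z = trans (a≡a%ℕn+[a/ℕn]*n z n) (cong (λ r → + r + (z /ℕ n) * + n) (sym (toℕ-[] z)))

    []-≡ : ∀ {x y} k → x ≡ y + k * + n → [ x ] ≡ [ y ]
    []-≡ {x} {y} k eq = FinP.toℕ-injective
      (residue-unique (y /ℕ n + k - x /ℕ n) (FinP.toℕ<n [ x ]) (FinP.toℕ<n [ y ]) (begin
        + toℕ [ x ]                                          ≡⟨ isolate (+ toℕ [ x ]) (x /ℕ n * + n) ⟩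
        (+ toℕ [ x ] + x /ℕ n * + n) - x /ℕ n * + n          ≡⟨ cong (_- x /ℕ n * + n) (trans (sym (decompose x)) eq) ⟩
        y + k * + n - x /ℕ n * + n                           ≡⟨ cong (λ u → u + k * + n - x /ℕ n * + n) (decompose y) ⟩
        + toℕ [ y ] + y /ℕ n * + n + k * + n - x /ℕ n * + n  ≡⟨ regroup (+ toℕ [ y ]) (y /ℕ n) k (x /ℕ n) (+ n) ⟩
        + toℕ [ y ] + (y /ℕ n + k - x /ℕ n) * + n            ∎))
      where
      open ≡-Reasoning
      isolate : ∀ a b → a ≡ (a + b) - b
      isolate = solve-∀
      regroup : ∀ r q k p m → r + q * m + k * m - p * m ≡ r + (q + k - p) * m
      regroup = solve-∀

    []-≡⁻¹ : ∀ {x y} → [ x ] ≡ [ y ] → Σ ℤ λ k → x ≡ y + k * + n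
    []-≡⁻¹ {x} {y} eq = x /ℕ n - y /ℕ n , (begin
      x                                            ≡⟨ decompose x ⟩
      + toℕ [ x ] + x /ℕ n * + n                   ≡⟨ cong (λ v → + toℕ v + x /ℕ n * + n) eq ⟩
      + toℕ [ y ] + x /ℕ n * + n                   ≡⟨ regroup (+ toℕ [ y ]) (x /ℕ n) (y /ℕ n) (+ n) ⟩
      (+ toℕ [ y ] + y /ℕ n * + n) + (x /ℕ n - y /ℕ n) * + n ≡⟨ cong (_+ (x /ℕ n - y /ℕ n) * + n) (sym (decompose y)) ⟩
      y + (x /ℕ n - y /ℕ n) * + n                  ∎)
      where
      open ≡-Reasoning
      regroup : ∀ r p q m → r + p * m ≡ (r + q * m) + (p - q) * m
      regroup = solve-∀

    []-+ : ∀ {x x' y y'} → [ x ] ≡ [ x' ] → [ y ] ≡ [ y' ] → [ x + y ] ≡ [ x' + y' ]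
    []-+ {x} {x'} {y} {y'} ex ey with []-≡⁻¹ {x} {x'} ex | []-≡⁻¹ {y} {y'} ey
    ... | k , refl | l , refl = []-≡ {x' + k * + n + (y' + l * + n)} {x' + y'} (k + l) (regroup x' y' k l (+ n))
      where
      regroup : ∀ a b k l m → a + k * m + (b + l * m) ≡ a + b + (k + l) * m
      regroup = solve-∀

    []-neg : ∀ {x x'} → [ x ] ≡ [ x' ] → [ - x ] ≡ [ - x' ]
    []-neg {x} {x'} ex with []-≡⁻¹ {x} {x'} ex
    ... | k , refl = []-≡ { - (x' + k * + n)} { - x'} (- k) (regroup x' k (+ n))
      where
      regroup : ∀ a k m → - (a + k * m) ≡ - a + (- k) * m
      regroup = solve-∀

    []-toℕ : ∀ v → [ + toℕ v ] ≡ v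
    []-toℕ v = FinP.toℕ-injective (trans (toℕ-[] (+ toℕ v)) (ℕD.m<n⇒m%n≡m (FinP.toℕ<n v)))

    ⊕-[] : ∀ x y → _⊕_ n [ x ] [ y ] ≡ [ x + y ]
    ⊕-[] x y = []-+ {+ toℕ [ x ]} {x} {+ toℕ [ y ]} {y} ([]-toℕ [ x ]) ([]-toℕ [ y ])

    ⊝-[] : ∀ x → ⊝ n [ x ] ≡ [ - x ]
    ⊝-[] x = trans ([]-≡ {+ (n ℕ.∸ r)} { - + r} 1ℤ n-r≡) ([]-neg {+ r} {x} ([]-toℕ [ x ]))
      where
      r = toℕ [ x ]
      n-r≡ : + (n ℕ.∸ r) ≡ - + r + 1ℤ * + n
      n-r≡ = trans (sym (ℤP.⊖-≥ (ℕP.<⇒≤ (FinP.toℕ<n [ x ]))))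
                   (trans (sym (ℤP.m-n≡m⊖n n r)) (commute (+ n) (+ r)))
        where
        commute : ∀ m a → m - a ≡ - a + 1ℤ * m
        commute = solve-∀

    Lifts : ∀ {k} → (ℕ → ℤ) → Vec (Fin n) (suc k) → Set
    Lifts F (v ∷ [])      = [ F 0 ] ≡ v
    Lifts F (v ∷ v' ∷ vs) = [ F 0 ] ≡ v × Lifts (F ∘ suc) (v' ∷ vs)

    Lifts-head : ∀ {k F} (w : Vec (Fin n) (suc k)) → Lifts F w → [ F 0 ] ≡ head w
    Lifts-head (_ ∷ [])     F₀ = F₀
    Lifts-head (_ ∷ _ ∷ _) (F₀ , _) = F₀

    Lifts-resp : ∀ {k F G} → (∀ t → [ F t ] ≡ [ G t ]) → (w : Vec (Fin n) (suc k)) → Lifts F w → Lifts G w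
    Lifts-resp F≈G (_ ∷ [])      F₀ = trans (sym (F≈G 0)) F₀
    Lifts-resp F≈G (_ ∷ v' ∷ vs) (F₀ , Fw) = trans (sym (F≈G 0)) F₀ , Lifts-resp (F≈G ∘ suc) (v' ∷ vs) Fw

    Lifts-map : ∀ {k F} {f : Fin n → Fin n} {g : ℤ → ℤ} → (∀ z → f [ z ] ≡ [ g z ]) →
                (w : Vec (Fin n) (suc k)) → Lifts F w → Lifts (g ∘ F) (mapVec n f w)
    Lifts-map {F = F} {f} {g} fg (_ ∷ [])      F₀ = trans (sym (fg (F 0))) (cong f F₀)
    Lifts-map {F = F} {f} {g} fg (_ ∷ v' ∷ vs) (F₀ , Fw) =
      trans (sym (fg (F 0))) (cong f F₀) , Lifts-map {F = F ∘ suc} {f} {g} fg (v' ∷ vs) Fw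

    private
      move : ∀ {v v'} → Step n v v' → ℤ
      move (inj₁ _)        = 1ℤ
      move (inj₂ (inj₁ _)) = 0ℤ
      move (inj₂ (inj₂ _)) = - 1ℤ

      step-lifts : ∀ {z v v'} → [ z ] ≡ v → (st : Step n v v') → [ z + move st ] ≡ v'
      step-lifts {z} refl (inj₁ e)        = sym (trans e (⊕-[] z 1ℤ))
      step-lifts {z} refl (inj₂ (inj₁ e)) = sym (trans e (cong [_] (sym (ℤP.+-identityʳ z))))
      step-lifts {z} refl (inj₂ (inj₂ e)) = sym (trans e (trans (cong (_⊕_ n [ z ]) (⊝-[] 1ℤ)) (⊕-[] z (- 1ℤ))))

      step-bounded : ∀ z {v v'} (st : Step n v v') → (z + move st) - z ∈[ - 1ℤ , 1ℤ ]
      step-bounded z st = subst (_∈[ - 1ℤ , 1ℤ ]) (cancel z (move st)) (bounded st)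
        where
        cancel : ∀ z s → s ≡ (z + s) - z
        cancel = solve-∀
        bounded : ∀ {v v'} (st : Step n v v') → move st ∈[ - 1ℤ , 1ℤ ]
        bounded (inj₁ _)        = ℤ.-≤+ , ℤP.≤-refl
        bounded (inj₂ (inj₁ _)) = ℤ.-≤+ , +≤+ z≤n
        bounded (inj₂ (inj₂ _)) = ℤP.≤-refl , ℤ.-≤+

      constant-bounded : ∀ z → z - z ∈[ - 1ℤ , 1ℤ ]
      constant-bounded z = subst (_∈[ - 1ℤ , 1ℤ ]) (sym (ℤP.+-inverseʳ z)) (ℤ.-≤+ , +≤+ z≤n)

      lift : ∀ {k} (w : Vec (Fin n) (suc k)) → ValidWalk n w → ℤ → ℕ → ℤ
      lift _             _        z zero    = z
      lift (_ ∷ [])      _        z (suc _) = z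
      lift (_ ∷ v' ∷ vs) (st , p) z (suc t) = lift (v' ∷ vs) p (z + move st) t

      lift-lifts : ∀ {k} (w : Vec (Fin n) (suc k)) p z → [ z ] ≡ head w → Lifts (lift w p z) w
      lift-lifts (_ ∷ [])      _        _ z₀ = z₀
      lift-lifts (_ ∷ v' ∷ vs) (st , p) z z₀ = z₀ , lift-lifts (v' ∷ vs) p (z + move st) (step-lifts {z} z₀ st)

      lift-steps : ∀ {k} (w : Vec (Fin n) (suc k)) p z t → lift w p z (suc t) - lift w p z t ∈[ - 1ℤ , 1ℤ ]
      lift-steps (_ ∷ [])      _        z zero    = constant-bounded z
      lift-steps (_ ∷ [])      _        z (suc _) = constant-bounded z
      lift-steps (_ ∷ _ ∷ _)   (st , _) z zero    = step-bounded z st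
      lift-steps (_ ∷ v' ∷ vs) (st , p) z (suc t) = lift-steps (v' ∷ vs) p (z + move st) t

    walk-lift : ∀ {k} (w : Vec (Fin n) (suc k)) → ValidWalk n w → Σ (ℕ → ℤ) λ F → Lifts F w × Lipschitz F
    walk-lift w p = lift w p z , lift-lifts w p z ([]-toℕ (head w)) , lipschitz (lift-steps w p z)
      where z = + toℕ (head w)

    separated-distinct : ∀ {x y} → x - y ∈[ 1ℤ , + n - 1ℤ ] → [ x ] ≢ [ y ]
    separated-distinct {x} {y} (lo , hi) eq with []-≡⁻¹ {x} {y} eq
    ... | k , refl with multiple-≤0⊎≥ k n
    ...   | inj₁ kN≤0 = certified-absurd 0 (0≤+ (slack lo) (slack kN≤0)) (low y (k * + n))
      where
      low : ∀ y K → ((y + K) - y - 1ℤ) + (0ℤ - K) ≡ - 1ℤ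
      low = solve-∀
    ...   | inj₂ N≤kN = certified-absurd 0 (0≤+ (slack hi) (slack N≤kN)) (high y (k * + n) (+ n))
      where
      high : ∀ y K N → (N - 1ℤ - ((y + K) - y)) + (K - N) ≡ - 1ℤ
      high = solve-∀

    -- The certificate identities are opaque: unfolding the solver's proofs while checking these
    -- clauses is very slow.
    crossing-impossible : ∀ {x₀ x₁ y₀ y₁} → 3 ℕ.≤ n →
      x₁ - x₀ ∈[ - 1ℤ , 1ℤ ] → y₁ - y₀ ∈[ - 1ℤ , 1ℤ ] →
      x₀ - y₀ ∈[ 1ℤ , + n - 1ℤ ] → x₁ - y₁ ∈[ 1ℤ , + n - 1ℤ ] →
      [ x₀ ] ≡ [ y₁ ] → [ x₁ ] ≡ [ y₀ ] → ⊥
    crossing-impossible {x₀} {x₁} {y₀} {y₁} 3≤n (a-lo , a-hi) (b-lo , b-hi) (d₀-lo , d₀-hi) (d₁-lo , d₁-hi) e₀ e₁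
      with []-≡⁻¹ {x₀} {y₁} e₀ | []-≡⁻¹ {x₁} {y₀} e₁
    ... | k , refl | l , refl with multiple-≤0⊎≥ k n | multiple-≤0⊎≥ l n
    ... | inj₁ P≤0 | inj₁ Q≤0 =
      certified-absurd 1 (0≤+ (0≤+ (slack P≤0) (slack Q≤0)) (0≤+ (slack d₀-lo) (slack d₁-lo)))
        (both-low y₀ y₁ (k * + n) (l * + n))
      where
      opaque
        both-low : ∀ y₀ y₁ P Q → ((0ℤ - P) + (0ℤ - Q)) + (((y₁ + P) - y₀ - 1ℤ) + ((y₀ + Q) - y₁ - 1ℤ)) ≡ - + 2
        both-low = solve-∀
    ... | inj₂ N≤P | inj₂ N≤Q =
      certified-absurd 1 (0≤+ (0≤+ (slack N≤P) (slack N≤Q)) (0≤+ (slack d₀-hi) (slack d₁-hi)))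
        (both-high y₀ y₁ (k * + n) (l * + n) (+ n))
      where
      opaque
        both-high : ∀ y₀ y₁ P Q N →
          ((P - N) + (Q - N)) + ((N - 1ℤ - ((y₁ + P) - y₀)) + (N - 1ℤ - ((y₀ + Q) - y₁))) ≡ - + 2
        both-high = solve-∀
    ... | inj₁ P≤0 | inj₂ N≤Q =
      certified-absurd 0 (0≤+ (0≤+ (slack P≤0) (slack N≤Q)) (0≤+ (0≤+ (slack a-hi) (slack b-hi)) (slack (+≤+ 3≤n))))
        (apart y₀ y₁ (k * + n) (l * + n) (+ n))
      where
      opaque
        apart : ∀ y₀ y₁ P Q N →
          ((0ℤ - P) + (Q - N)) + (((1ℤ - ((y₀ + Q) - (y₁ + P))) + (1ℤ - (y₁ - y₀))) + (N - + 3)) ≡ - 1ℤ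
        apart = solve-∀
    ... | inj₂ N≤P | inj₁ Q≤0 =
      certified-absurd 0 (0≤+ (0≤+ (slack N≤P) (slack Q≤0)) (0≤+ (0≤+ (slack a-lo) (slack b-lo)) (slack (+≤+ 3≤n))))
        (apart y₀ y₁ (k * + n) (l * + n) (+ n))
      where
      opaque
        apart : ∀ y₀ y₁ P Q N →
          ((P - N) + (0ℤ - Q)) + (((((y₀ + Q) - (y₁ + P)) - - 1ℤ) + ((y₁ - y₀) - - 1ℤ)) + (N - + 3)) ≡ - 1ℤ
        apart = solve-∀

    ¬meets : ∀ {k F G} (a c : Vec (Fin n) (suc k)) → 3 ℕ.≤ n → Lifts F a → Lifts G c → Lipschitz F → Lipschitz G →
             (∀ t → t ℕ.≤ k → F t - G t ∈[ 1ℤ , + n - 1ℤ ]) → meets n a c ≡ false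
    ¬meets {F = F} {G} (v ∷ []) (u ∷ []) _ F₀ G₀ _ _ sep =
      isYes-false (v Fin.≟ u) (λ v≡u → separated-distinct {F 0} {G 0} (sep 0 z≤n) (trans F₀ (trans v≡u (sym G₀))))
    ¬meets {F = F} {G} (v ∷ v' ∷ vs) (u ∷ u' ∷ us) 3≤n (F₀ , Fa) (G₀ , Gc) lipF lipG sep =
      cong₂ _∨_ (isYes-false (v Fin.≟ u) (λ v≡u → separated-distinct {F 0} {G 0} (sep 0 z≤n) (trans F₀ (trans v≡u (sym G₀)))))
        (cong₂ _∨_ (∧-false (v Fin.≟ u') (v' Fin.≟ u) no-crossing)
                   (¬meets (v' ∷ vs) (u' ∷ us) 3≤n Fa Gc (Lipschitz-suc lipF) (Lipschitz-suc lipG)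
                           (λ t t≤k → sep (suc t) (s≤s t≤k))))
      where
      no-crossing : v ≡ u' → v' ≡ u → ⊥
      no-crossing v≡u' v'≡u =
        crossing-impossible {F 0} {F 1} {G 0} {G 1} 3≤n (step lipF 0) (step lipG 0) (sep 0 z≤n) (sep 1 (s≤s z≤n))
        (trans F₀ (trans v≡u' (sym (Lifts-head (u' ∷ us) Gc)))) (trans (Lifts-head (v' ∷ vs) Fa) (trans v'≡u (sym G₀)))

    good-shifts : ∀ {k} → Vec (Fin n) (suc k) → (Fin n → Vec (Fin n) (suc k)) → ℕ
    good-shifts a c = ∑[ s < n ] 𝟙 (not (meets n a (c s)))

    window⇒good : ∀ {k a c F H P w} → 3 ℕ.≤ n → w ℕ.≤ n →
      Lifts F a → (∀ s → Lifts (λ t → H t + + toℕ s) (c s)) → Lipschitz F → Lipschitz H →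
      InWindow k (λ t → F t - H t) P w → n ℕ.≤ good-shifts {k} a c ℕ.+ w
    window⇒good {k} {a} {c} {F} {H} {P} {w} 3≤n w≤n Fa Hc lipF lipH window = begin
      n                                ≡⟨ sym (trans (sum-const n 1) (ℕP.*-identityʳ n)) ⟩
      ∑[ s < n ] 1                     ≤⟨ sum-mono covered ⟩
      ∑[ s < n ] (A s ℕ.+ B s)         ≡⟨ ∑-distrib-+ A B ⟩
      good-shifts a c ℕ.+ ∑[ s < n ] B s      ≡⟨ cong (good-shifts a c ℕ.+_) count-near ⟩
      good-shifts a c ℕ.+ w                   ∎
      where
      open ℕP.≤-Reasoning

      -- A shift whose offset is at least w is good, and exactly w offsets are smaller.
      offset : Fin n → Fin n
      offset s = [ + toℕ s - P ]

      A B : Fin n → ℕ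
      A s = 𝟙 (not (meets n a (c s)))
      B s = 𝟙 (toℕ (offset s) <ᵇ w)

      far⇒¬meets : ∀ s → w ℕ.≤ toℕ (offset s) → meets n a (c s) ≡ false
      far⇒¬meets s w≤r = ¬meets a (c s) 3≤n Fa shifted-lifts lipF shifted-lipschitz separated
        where
        z = + toℕ s - P
        Q = (z /ℕ n) * + n

        shifted : ℕ → ℤ
        shifted t = H t + + toℕ s - (Q + + n)

        shifted-lifts : Lifts shifted (c s)
        shifted-lifts = Lifts-resp
          (λ t → []-≡ {H t + + toℕ s} {shifted t} (z /ℕ n + 1ℤ) (unshift (H t) (+ toℕ s) (z /ℕ n) (+ n)))
                                   (c s) (Hc s)
          where
          unshift : ∀ h S q N → h + S ≡ (h + S - (q * N + N)) + (q + 1ℤ) * N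
          unshift = solve-∀

        shifted-lipschitz : Lipschitz shifted
        shifted-lipschitz = lipschitz λ t → subst (_∈[ - 1ℤ , 1ℤ ]) (cancel (H (suc t)) (H t) (+ toℕ s) (Q + + n)) (step lipH t)
          where
          cancel : ∀ a b S R → a - b ≡ (a + S - R) - (b + S - R)
          cancel = solve-∀

        separated : ∀ t → t ℕ.≤ k → F t - shifted t ∈[ 1ℤ , + n - 1ℤ ]
        separated t t≤k = shifted-separation {F t} {H t} {Q = Q} S≡ (window t t≤k) (+≤+ w≤r) (<⇒1+≤ (FinP.toℕ<n (offset s)))
          where
          S≡ : + toℕ s ≡ P + (+ toℕ (offset s) + Q)
          S≡ = trans (split (+ toℕ s) P) (cong (λ u → P + u) (decompose z))
            where
            split : ∀ S P → S ≡ P + (S - P)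
            split = solve-∀

      covered : ∀ s → 1 ℕ.≤ A s ℕ.+ B s
      covered s with toℕ (offset s) <ᵇ w in near
      ... | true  = ℕP.m≤n+m 1 (A s)
      ... | false rewrite far⇒¬meets s (ℕP.≮⇒≥ (λ r<w → subst T near (ℕP.<⇒<ᵇ r<w))) = s≤s z≤n

      count-near : ∑[ s < n ] B s ≡ w
      count-near = trans (sym (sum-permute (λ s → 𝟙 (toℕ s <ᵇ w)) offset-permutation)) (count-below w≤n)
        where
        unoffset : Fin n → Fin n
        unoffset s = [ + toℕ s + P ]

        add-sub : ∀ a b → (a + b) - b ≡ a
        add-sub = solve-∀
        sub-add : ∀ a b → (a - b) + b ≡ a
        sub-add = solve-∀

        offset-permutation = permutation offset unoffset
          (λ s → trans ([]-+ {+ toℕ (unoffset s)} {+ toℕ s + P} { - P} { - P} ([]-toℕ [ + toℕ s + P ]) refl)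
                       (trans (cong [_] (add-sub (+ toℕ s) P)) ([]-toℕ s)))
          (λ s → trans ([]-+ {+ toℕ (offset s)} {+ toℕ s - P} {P} {P} ([]-toℕ [ + toℕ s - P ]) refl)
                       (trans (cong [_] (sub-add (+ toℕ s) P)) ([]-toℕ s)))

module Itineraries where

  open Integers
  open Counting
  open import Data.Fin as Fin using (Fin; toℕ)
  open import Data.Fin.Patterns using (0F; 1F; 2F)
  import Data.Fin.Properties as FinP
  open import Data.Integer as ℤ using (ℤ; +_; +[1+_]; -[1+_]; 0ℤ; 1ℤ; _+_; _-_; _*_; -_; _≤_; +≤+; -≤-)
  import Data.Integer.Properties as ℤP
  open import Data.Integer.DivMod using (_%ℕ_; _/ℕ_; n%ℕd<d; a≡a%ℕn+[a/ℕn]*n)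
  open import Data.Integer.Tactic.RingSolver using (solve-∀)
  open import Data.Nat as ℕ using (ℕ; zero; suc; NonZero; z≤n; s≤s)
  import Data.Nat.DivMod as ℕD
  import Data.Nat.Properties as ℕP
  open import Algebra.Properties.CommutativeMonoid.Sum ℕP.+-0-commutativeMonoid using (sum-syntax)
  import Data.Nat.Tactic.RingSolver as ℕ-Solver
  open import Data.Product using (Σ; _×_; _,_; proj₁; proj₂)
  open import Data.Sum using (inj₁; inj₂)
  open import Data.Vec using (Vec; tabulate; lookup)
  import Data.Vec.Properties as VecP
  open import Relation.Binary using (DecidableEquality)
  open import Relation.Binary.PropositionalEquality
  open import Relation.Nullary using (does)

  code : ℤ → Fin 3
  code -[1+ _ ] = 0F
  code (+ 0)    = 1F
  code +[1+ _ ] = 2F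

  decode : Fin 3 → ℤ
  decode 0F = - 1ℤ
  decode 1F = 0ℤ
  decode 2F = 1ℤ

  decode-code : ∀ {x} → x ∈[ - 1ℤ , 1ℤ ] → decode (code x) ≡ x
  decode-code {+ 0}          _                = refl
  decode-code {+[1+ 0 ]}     _                = refl
  decode-code {+[1+ suc _ ]} (_ , +≤+ (s≤s ()))
  decode-code { -[1+ 0 ]}    _                = refl
  decode-code { -[1+ suc _ ]} (-≤- () , _)

  near-arith : ∀ {t τ ρ r h I M} → t ≡ ρ + I → τ ≡ h + I → M ≡ r + (h + h) →
    ρ ∈[ 0ℤ , M - 1ℤ ] → r ∈[ 0ℤ , 1ℤ ] → (t - τ) + (t - τ) ∈[ - M , M ]
  near-arith {ρ = ρ} {r} {h} {I} refl refl refl (0≤ρ , ρ<M) (0≤r , r≤1) =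
    ≤-certified (0≤+ (0≤+ (slack 0≤ρ) (slack 0≤ρ)) (slack 0≤r)) (lower ρ r h I) ,
    ≤-certified (0≤+ (0≤+ (slack ρ<M) (slack ρ<M)) (0≤+ (slack r≤1) (0≤ℕ 1))) (upper ρ r h I)
    where
    lower : ∀ ρ r h I → ((ρ - 0ℤ) + (ρ - 0ℤ)) + (r - 0ℤ) ≡ (((ρ + I) - (h + I)) + ((ρ + I) - (h + I))) - - (r + (h + h))
    lower = solve-∀
    upper : ∀ ρ r h I → (((r + (h + h) - 1ℤ) - ρ) + ((r + (h + h) - 1ℤ) - ρ)) + ((1ℤ - r) + 1ℤ) ≡
                        (r + (h + h)) - (((ρ + I) - (h + I)) + ((ρ + I) - (h + I)))
    upper = solve-∀

  collision-tradeoff : ∀ {m k c} → c ℕ.≤ m ℕ.* k → c ℕ.≤ m ℕ.* m → 3 ℕ.* c ℕ.≤ m ℕ.* (2 ℕ.* m ℕ.+ k)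
  collision-tradeoff {m} {k} {c} c≤mk c≤mm with ℕP.≤-total k m
  ... | inj₁ k≤m = begin
    3 ℕ.* c                              ≤⟨ ℕP.*-monoʳ-≤ 3 c≤mk ⟩
    3 ℕ.* (m ℕ.* k)                      ≡⟨ split m k ⟩
    m ℕ.* k ℕ.+ 2 ℕ.* (m ℕ.* k)          ≤⟨ ℕP.+-monoʳ-≤ (m ℕ.* k) (ℕP.*-monoʳ-≤ 2 (ℕP.*-monoʳ-≤ m k≤m)) ⟩
    m ℕ.* k ℕ.+ 2 ℕ.* (m ℕ.* m)          ≡⟨ factor m k ⟩
    m ℕ.* (2 ℕ.* m ℕ.+ k)                ∎
    where
    open ℕP.≤-Reasoning
    split : ∀ m k → 3 ℕ.* (m ℕ.* k) ≡ m ℕ.* k ℕ.+ 2 ℕ.* (m ℕ.* k)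
    split = ℕ-Solver.solve-∀
    factor : ∀ m k → m ℕ.* k ℕ.+ 2 ℕ.* (m ℕ.* m) ≡ m ℕ.* (2 ℕ.* m ℕ.+ k)
    factor = ℕ-Solver.solve-∀
  ... | inj₂ m≤k = begin
    3 ℕ.* c                              ≤⟨ ℕP.*-monoʳ-≤ 3 c≤mm ⟩
    3 ℕ.* (m ℕ.* m)                      ≡⟨ split m ⟩
    2 ℕ.* (m ℕ.* m) ℕ.+ m ℕ.* m          ≤⟨ ℕP.+-monoʳ-≤ (2 ℕ.* (m ℕ.* m)) (ℕP.*-monoʳ-≤ m m≤k) ⟩
    2 ℕ.* (m ℕ.* m) ℕ.+ m ℕ.* k          ≡⟨ factor m k ⟩
    m ℕ.* (2 ℕ.* m ℕ.+ k)                ∎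
    where
    open ℕP.≤-Reasoning
    split : ∀ m → 3 ℕ.* (m ℕ.* m) ≡ 2 ℕ.* (m ℕ.* m) ℕ.+ m ℕ.* m
    split = ℕ-Solver.solve-∀
    factor : ∀ m k → 2 ℕ.* (m ℕ.* m) ℕ.+ m ℕ.* k ≡ m ℕ.* (2 ℕ.* m ℕ.+ k)
    factor = ℕ-Solver.solve-∀

  _≟ᵛ_ : ∀ {q} → DecidableEquality (Vec (Fin 3) q)
  _≟ᵛ_ = VecP.≡-dec Fin._≟_

  module Blocks (m : ℕ) .{{_ : NonZero m}} (T : ℕ) where

    q : ℕ
    q = T ℕD./ m

    -- Centring the block times at ⌊m/2⌋ puts every time within m/2 of one of them (near-block).
    h : ℕ
    h = m ℕD./ 2

    τ : ℕ → ℕ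
    τ i = h ℕ.+ i ℕ.* m

    position : (ℕ → ℤ) → Fin m → ℕ → ℤ
    position F ρ i = + toℕ ρ + (F (τ i) - F (τ 0))

    cell : (ℕ → ℤ) → Fin m → ℕ → ℤ
    cell F ρ i = position F ρ i /ℕ m

    itinerary : (ℕ → ℤ) → Fin m → Vec (Fin 3) q
    itinerary F ρ = tabulate (λ j → code (cell F ρ (suc (toℕ j)) - cell F ρ (toℕ j)))

    private
      residue-∈ : ∀ {r} → r ℕ.< m → + r ∈[ 0ℤ , + m - 1ℤ ]
      residue-∈ {r} r<m = +≤+ z≤n , ≤-certified (slack (<⇒1+≤ r<m)) (lower (+ m) (+ r))
        where
        lower : ∀ m r → m - (1ℤ + r) ≡ (m - 1ℤ) - r
        lower = solve-∀

      position-∈ : ∀ F ρ i → + (position F ρ i %ℕ m) ∈[ 0ℤ , + m - 1ℤ ]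
      position-∈ F ρ i = residue-∈ (n%ℕd<d (position F ρ i) m)

    cell-zero : ∀ F ρ → cell F ρ 0 ≡ 0ℤ
    cell-zero F ρ = trans (cong (_/ℕ m) (trans (cong (λ d → + toℕ ρ + d) (ℤP.+-inverseʳ (F (τ 0))))
                                               (ℤP.+-identityʳ (+ toℕ ρ))))
                          (cong +_ (ℕD.m<n⇒m/n≡0 (FinP.toℕ<n ρ)))

    cell-step : ∀ {F} → Lipschitz F → ∀ ρ i → cell F ρ (suc i) - cell F ρ i ∈[ - 1ℤ , 1ℤ ]
    cell-step {F} lip ρ i = quotient-step {a = cell F ρ i} {cell F ρ (suc i)}
                                          (a≡a%ℕn+[a/ℕn]*n (position F ρ i) m) (a≡a%ℕn+[a/ℕn]*n (position F ρ (suc i)) m)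
                                          (position-∈ F ρ i) (position-∈ F ρ (suc i)) moves
      where
      τ-suc : τ (suc i) ≡ m ℕ.+ τ i
      τ-suc = swap h m (i ℕ.* m)
        where
        swap : ∀ a b c → a ℕ.+ (b ℕ.+ c) ≡ b ℕ.+ (a ℕ.+ c)
        swap = ℕ-Solver.solve-∀
      moves : position F ρ (suc i) - position F ρ i ∈[ - + m , + m ]
      moves = ∈-resp (trans (cong (λ u → F u - F (τ i)) (sym τ-suc)) (cancel (+ toℕ ρ) (F (τ (suc i))) (F (τ i)) (F (τ 0))))
                     refl refl (lipschitz-gap lip (τ i) m)
        where
        cancel : ∀ r a b c → a - b ≡ (r + (a - c)) - (r + (b - c))
        cancel = solve-∀

    itinerary-lookup : ∀ F ρ {i} (i<q : i ℕ.< q) →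
                       lookup (itinerary F ρ) (Fin.fromℕ< i<q) ≡ code (cell F ρ (suc i) - cell F ρ i)
    itinerary-lookup F ρ i<q = trans (VecP.lookup∘tabulate _ (Fin.fromℕ< i<q))
                                     (cong (λ k → code (cell F ρ (suc k) - cell F ρ k)) (FinP.toℕ-fromℕ< i<q))

    same-itinerary⇒same-cell : ∀ {F G ρ ρ'} → Lipschitz F → Lipschitz G → itinerary F ρ ≡ itinerary G ρ' →
                               ∀ i → i ℕ.≤ q → cell F ρ i ≡ cell G ρ' i
    same-itinerary⇒same-cell {F} {G} {ρ} {ρ'} _ _ _ zero _ = trans (cell-zero F ρ) (sym (cell-zero G ρ'))
    same-itinerary⇒same-cell {F} {G} {ρ} {ρ'} lipF lipG same (suc i) i<q = begin
      cell F ρ (suc i)                                  ≡⟨ split (cell F ρ (suc i)) (cell F ρ i) ⟩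
      cell F ρ i + (cell F ρ (suc i) - cell F ρ i)
        ≡⟨ cong₂ _+_ (same-itinerary⇒same-cell lipF lipG same i (ℕP.<⇒≤ i<q)) same-step ⟩
      cell G ρ' i + (cell G ρ' (suc i) - cell G ρ' i)   ≡⟨ sym (split (cell G ρ' (suc i)) (cell G ρ' i)) ⟩
      cell G ρ' (suc i)                                 ∎
      where
      open ≡-Reasoning
      split : ∀ a b → a ≡ b + (a - b)
      split = solve-∀
      same-step : cell F ρ (suc i) - cell F ρ i ≡ cell G ρ' (suc i) - cell G ρ' i
      same-step = begin
        cell F ρ (suc i) - cell F ρ i                  ≡⟨ decode-code (cell-step lipF ρ i) ⟨
        decode (code (cell F ρ (suc i) - cell F ρ i))   ≡⟨ cong decode (itinerary-lookup F ρ i<q) ⟨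
        decode (lookup (itinerary F ρ) (Fin.fromℕ< i<q))  ≡⟨ cong (λ v → decode (lookup v (Fin.fromℕ< i<q))) same ⟩
        decode (lookup (itinerary G ρ') (Fin.fromℕ< i<q)) ≡⟨ cong decode (itinerary-lookup G ρ' i<q) ⟩
        decode (code (cell G ρ' (suc i) - cell G ρ' i)) ≡⟨ decode-code (cell-step lipG ρ' i) ⟩
        cell G ρ' (suc i) - cell G ρ' i                ∎

    drift : (ℕ → ℤ) → (ℕ → ℤ) → ℕ → ℤ
    drift F G i = (F (τ i) - G (τ i)) - (F (τ 0) - G (τ 0))

    matched-offset : ∀ {F G ρ ρ'} → Lipschitz F → Lipschitz G → itinerary F ρ ≡ itinerary G ρ' → ∀ i → i ℕ.≤ q →
      + toℕ ρ' - + toℕ ρ ∈[ drift F G i - (+ m - 1ℤ) , drift F G i + (+ m - 1ℤ) ]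
    matched-offset {F} {G} {ρ} {ρ'} lipF lipG same i i≤q =
      ∈-resp (offset (+ toℕ ρ) (+ toℕ ρ') (F (τ i)) (F (τ 0)) (G (τ i)) (G (τ 0))) refl
             (cong (λ x → drift F G i + x) (ℤP.neg-involutive (+ m - 1ℤ)))
             (∈-+ (ℤP.≤-refl {drift F G i} , ℤP.≤-refl) (∈-neg close))
      where
      close : position F ρ i - position G ρ' i ∈[ - (+ m - 1ℤ) , + m - 1ℤ ]
      close = same-quotient {r = + (position F ρ i %ℕ m)} {+ (position G ρ' i %ℕ m)} {a = cell F ρ i} {M = + m}
        (a≡a%ℕn+[a/ℕn]*n (position F ρ i) m)
        (trans (a≡a%ℕn+[a/ℕn]*n (position G ρ' i) m)
               (cong (λ c → + (position G ρ' i %ℕ m) + c * + m) (sym (same-itinerary⇒same-cell lipF lipG same i i≤q))))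
        (position-∈ F ρ i) (position-∈ G ρ' i)
      offset : ∀ r r' a b c d → ((a - c) - (b - d)) + - ((r + (a - b)) - (r' + (c - d))) ≡ r' - r
      offset = solve-∀

    near-block : ∀ t → (+ t - + τ (t ℕD./ m)) + (+ t - + τ (t ℕD./ m)) ∈[ - + m , + m ]
    near-block t = near-arith {r = + (m ℕD.% 2)} {h = + h} {I = + (t ℕD./ m ℕ.* m)}
                              (cong +_ (ℕD.m≡m%n+[m/n]*n t m)) refl (cong +_ halves)
                              (residue-∈ (ℕD.m%n<n t m)) (+≤+ z≤n , +≤+ (ℕP.≤-pred (ℕD.m%n<n m 2)))
      where
      halves : m ≡ m ℕD.% 2 ℕ.+ (h ℕ.+ h)
      halves = trans (ℕD.m≡m%n+[m/n]*n m 2) (cong (m ℕD.% 2 ℕ.+_) (double h))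
        where
        double : ∀ h → h ℕ.* 2 ≡ h ℕ.+ h
        double = ℕ-Solver.solve-∀

    displacement : ∀ {F G} → Lipschitz F → Lipschitz G → ∀ {s t} → s ℕ.≤ t → (+ t - + s) + (+ t - + s) ≤ + m →
                   (F t - G t) - (F s - G s) ∈[ - + m , + m ]
    displacement {F} {G} lipF lipG {s} {t} s≤t 2d≤m =
      ≤-certified (0≤+ (0≤+ (slack (proj₁ dF)) (slack (proj₂ dG))) (slack 2d≤m)) (lower (F t) (F s) (G t) (G s) (+ t - + s) (+ m)) ,
      ≤-certified (0≤+ (0≤+ (slack (proj₂ dF)) (slack (proj₁ dG))) (slack 2d≤m)) (upper (F t) (F s) (G t) (G s) (+ t - + s) (+ m))
      where
      dF = lipschitz-between lipF s≤t
      dG = lipschitz-between lipG s≤t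
      lower : ∀ a b c d D M → (((a - b) - - D) + (D - (c - d))) + (M - (D + D)) ≡ ((a - c) - (b - d)) - - M
      lower = solve-∀
      upper : ∀ a b c d D M → ((D - (a - b)) + ((c - d) - - D)) + (M - (D + D)) ≡ M - ((a - c) - (b - d))
      upper = solve-∀

    drift-window : ∀ {F G} → Lipschitz F → Lipschitz G → ∀ t → t ℕ.≤ T →
      Σ ℕ λ i → i ℕ.≤ q × (F t - G t) - (F (τ 0) - G (τ 0)) ∈[ drift F G i - + m , drift F G i + + m ]
    drift-window {F} {G} lipF lipG t t≤T = i , ℕD./-monoˡ-≤ m t≤T ,
      ∈-resp (recombine (F t) (G t) (F (τ i)) (G (τ i)) (F (τ 0)) (G (τ 0)))
             (ℤP.+-comm (- + m) (drift F G i)) (ℤP.+-comm (+ m) (drift F G i))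
             (∈-+ near (ℤP.≤-refl {drift F G i} , ℤP.≤-refl))
      where
      i = t ℕD./ m
      recombine : ∀ a b c d e f → ((a - b) - (c - d)) + ((c - d) - (e - f)) ≡ (a - b) - (e - f)
      recombine = solve-∀
      near : (F t - G t) - (F (τ i) - G (τ i)) ∈[ - + m , + m ]
      near with ℕP.≤-total (τ i) t
      ... | inj₁ τ≤t = displacement lipF lipG τ≤t (proj₂ (near-block t))
      ... | inj₂ t≤τ = ∈-resp (flip (F t) (G t) (F (τ i)) (G (τ i))) refl (ℤP.neg-involutive (+ m))
                              (∈-neg (displacement lipF lipG t≤τ twice-gap))
        where
        flip : ∀ a b c d → - ((c - d) - (a - b)) ≡ (a - b) - (c - d)
        flip = solve-∀
        twice-gap : (+ τ i - + t) + (+ τ i - + t) ≤ + m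
        twice-gap = ≤-certified (slack (proj₁ (near-block t))) (reflect (+ t) (+ τ i) (+ m))
          where
          reflect : ∀ t τ M → ((t - τ) + (t - τ)) - - M ≡ M - ((τ - t) + (τ - t))
          reflect = solve-∀

    occupancy : (ℕ → ℤ) → Vec (Fin 3) q → ℕ
    occupancy F δ = ∑[ ρ < m ] 𝟙 (does (itinerary F ρ ≟ᵛ δ))

    collisions : (ℕ → ℤ) → (ℕ → ℤ) → ℕ
    collisions F G = ∑[ ρ < m ] occupancy G (itinerary F ρ)

    -- Coinciding itineraries pin the phase offset to an interval of K integers (row-≤) and keep
    -- F − G in a window of 4m − K integers (in-window).
    module _ {F G : ℕ → ℤ} (lipF : Lipschitz F) (lipG : Lipschitz G) where

      private
        top    = argmax (drift F G) q
        bottom = argmax (λ i → - drift F G i) q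
        HI = drift F G (proj₁ top)
        LO = drift F G (proj₁ bottom)

        below-top : ∀ i → i ℕ.≤ q → drift F G i ≤ HI
        below-top = proj₂ (proj₂ top)

        above-bottom : ∀ i → i ℕ.≤ q → LO ≤ drift F G i
        above-bottom i i≤q = ℤP.neg-cancel-≤ (proj₂ (proj₂ bottom) i i≤q)

        matched : ∀ {ρ ρ'} → itinerary G ρ' ≡ itinerary F ρ → + toℕ ρ' - + toℕ ρ ∈[ HI - (+ m - 1ℤ) , LO + (+ m - 1ℤ) ]
        matched same = proj₁ (matched-offset lipF lipG (sym same) (proj₁ top) (proj₁ (proj₂ top))) ,
                       proj₂ (matched-offset lipF lipG (sym same) (proj₁ bottom) (proj₁ (proj₂ bottom)))

        base = F (τ 0) - G (τ 0)

        bounded : ∀ t → t ℕ.≤ T → F t - G t ∈[ base + (LO - + m) , base + (HI + + m) ]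
        bounded t t≤T with drift-window lipF lipG t t≤T
        ... | i , i≤q , window = ∈-resp (restore (F t - G t) base) refl refl
          (∈-+ (ℤP.≤-refl {base} , ℤP.≤-refl)
               (ℤP.≤-trans (ℤP.+-monoˡ-≤ (- + m) (above-bottom i i≤q)) (proj₁ window) ,
                ℤP.≤-trans (proj₂ window) (ℤP.+-monoˡ-≤ (+ m) (below-top i i≤q))))
          where
          restore : ∀ v b → b + (v - b) ≡ v
          restore = solve-∀

        α β K : ℤ
        α = HI - (+ m - 1ℤ)
        β = LO + (+ m - 1ℤ)
        K = β - α + 1ℤ

        row-≤ : ∀ {k} → K ≤ + k → ∀ ρ → occupancy G (itinerary F ρ) ℕ.≤ k
        row-≤ {k} K≤k ρ = count-interval _ (+ toℕ ρ + α) k λ ρ' hit →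
          let offset = matched (does-true (itinerary G ρ' ≟ᵛ itinerary F ρ) hit) in
          ≤-certified (slack (proj₁ offset)) (lower (+ toℕ ρ) (+ toℕ ρ') α) ,
          ≤-certified (0≤+ (slack (proj₂ offset)) (slack K≤k)) (upper (+ toℕ ρ) (+ toℕ ρ') α β (+ k))
          where
          lower : ∀ r r' a → (r' - r) - a ≡ r' - (r + a)
          lower = solve-∀
          upper : ∀ r r' a b k → (b - (r' - r)) + (k - (b - a + 1ℤ)) ≡ ((r + a) + k - 1ℤ) - r'
          upper = solve-∀

        window-width : ℕ
        window-width = ℤ.∣ (HI + + m) - (LO - + m) + 1ℤ ∣

        window-width≡ : + window-width ≡ (HI + + m) - (LO - + m) + 1ℤ
        window-width≡ =
          ℤP.0≤i⇒+∣i∣≡i (≤-certified (0≤+ (slack LO≤HI) (0≤+ (0≤+ (0≤ℕ m) (0≤ℕ m)) (0≤ℕ 1))) (width HI LO (+ m)))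
          where
          LO≤HI = ℤP.≤-trans (above-bottom 0 z≤n) (below-top 0 z≤n)
          width : ∀ HI LO M → (HI - LO) + ((M + M) + 1ℤ) ≡ ((HI + M) - (LO - M) + 1ℤ) - 0ℤ
          width = solve-∀

        in-window : InWindow T (λ t → F t - G t) (base + (LO - + m)) window-width
        in-window t t≤T =
          ∈-resp refl refl (trans (close-window base HI LO (+ m)) (cong (λ x → base + (LO - + m) + x - 1ℤ) (sym window-width≡)))
                 (bounded t t≤T)
          where
          close-window : ∀ b HI LO M → b + (HI + M) ≡ b + (LO - M) + ((HI + M) - (LO - M) + 1ℤ) - 1ℤ
          close-window = solve-∀

        width+K≡4m : ∀ {k} → + k ≡ K → window-width ℕ.+ k ≡ 4 ℕ.* m
        width+K≡4m {k} k≡K = ℤP.+-injective (begin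
          + (window-width ℕ.+ k)  ≡⟨ ℤP.pos-+ window-width k ⟩
          + window-width + + k    ≡⟨ cong₂ _+_ window-width≡ k≡K ⟩
          (HI + + m) - (LO - + m) + 1ℤ + K ≡⟨ total HI LO (+ m) ⟩
          + 4 * + m               ≡⟨ ℤP.pos-* 4 m ⟨
          + (4 ℕ.* m)             ∎)
          where
          open ≡-Reasoning
          total : ∀ HI LO M → ((HI + M) - (LO - M) + 1ℤ) + ((LO + (M - 1ℤ)) - (HI - (M - 1ℤ)) + 1ℤ) ≡ + 4 * M
          total = solve-∀

      collision-bound : ∀ {g} → (∀ {P w} → w ℕ.≤ 4 ℕ.* m → InWindow T (λ t → F t - G t) P w → 6 ℕ.* m ℕ.≤ g ℕ.+ w) →
                        3 ℕ.* collisions F G ℕ.≤ m ℕ.* g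
      collision-bound {g} window⇒good with ℤP.≤-total K 0ℤ
      ... | inj₁ K≤0 = ℕP.≤-trans (ℕP.*-monoʳ-≤ 3 (subst (collisions F G ℕ.≤_) (ℕP.*-zeroʳ m) (sum-≤-const (row-≤ K≤0)))) z≤n
      ... | inj₂ 0≤K = ℕP.≤-trans (collision-tradeoff {m} {k} (sum-≤-const (row-≤ (ℤP.≤-reflexive (sym k≡K))))
                                                          (sum-≤-const row-≤-m))
                                  (ℕP.*-monoʳ-≤ m 2m+k≤g)
        where
        k = ℤ.∣ K ∣
        k≡K : + k ≡ K
        k≡K = ℤP.0≤i⇒+∣i∣≡i 0≤K
        width≤4m : window-width ℕ.≤ 4 ℕ.* m
        width≤4m = subst (window-width ℕ.≤_) (width+K≡4m k≡K) (ℕP.m≤m+n window-width k)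
        row-≤-m : ∀ ρ → occupancy G (itinerary F ρ) ℕ.≤ m
        row-≤-m ρ = count-≤ (λ ρ' → does (itinerary G ρ' ≟ᵛ itinerary F ρ))
        2m+k≤g : 2 ℕ.* m ℕ.+ k ℕ.≤ g
        2m+k≤g = ℕP.+-cancelʳ-≤ window-width _ _ (begin
          2 ℕ.* m ℕ.+ k ℕ.+ window-width      ≡⟨ regroup m k window-width ⟩
          2 ℕ.* m ℕ.+ (window-width ℕ.+ k)    ≡⟨ cong (2 ℕ.* m ℕ.+_) (width+K≡4m k≡K) ⟩
          2 ℕ.* m ℕ.+ 4 ℕ.* m                 ≡⟨ six m ⟩
          6 ℕ.* m                             ≤⟨ window⇒good width≤4m in-window ⟩
          g ℕ.+ window-width                  ∎)
          where
          open ℕP.≤-Reasoning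
          regroup : ∀ m k w → 2 ℕ.* m ℕ.+ k ℕ.+ w ≡ 2 ℕ.* m ℕ.+ (w ℕ.+ k)
          regroup = ℕ-Solver.solve-∀
          six : ∀ m → 2 ℕ.* m ℕ.+ 4 ℕ.* m ≡ 6 ℕ.* m
          six = ℕ-Solver.solve-∀

module RationalSums where

  open import Defs using (_^ℚ_)
  open Counting
  open Itineraries
  open import Algebra.Bundles using (CommutativeMonoid)
  open import Data.Fin as Fin using (Fin)
  open import Data.Fin.Patterns using (0F; 1F; 2F)
  open import Data.Integer as ℤ using (+_)
  import Data.Integer.Properties as ℤP
  open import Data.List using (List; []; _∷_; map; foldr; tabulate; allFin)
  open import Data.List.Relation.Unary.All using (All; []; _∷_)
  open import Data.Nat as ℕ using (ℕ; zero; suc; NonZero)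
  open import Data.Nat.Coprimality using (1-coprimeTo)
  import Data.Nat.Coprimality as Coprimality
  import Data.Nat.Properties as ℕP
  open import Algebra.Properties.CommutativeMonoid.Sum ℕP.+-0-commutativeMonoid using (sum-syntax)
  open import Data.Rational as ℚ using (ℚ; mkℚ; _/_; 0ℚ; 1ℚ; _+_; _*_; _-_; _≤_)
  import Data.Rational.Properties as ℚP
  open import Algebra.Properties.CommutativeSemigroup (CommutativeMonoid.commutativeSemigroup ℚP.+-0-commutativeMonoid)
    using (interchange)
  open import Data.Rational.Solver using (module +-*-Solver)
  open import Data.Rational.Unnormalised as ℚᵘ using (mkℚᵘ; *≡*)
  import Data.Rational.Unnormalised.Properties as ℚᵘP
  open import Data.Sum using (inj₁; inj₂)
  open import Data.Vec using (Vec; _∷_; [])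
  open import Function using (_∘_; id)
  open import Relation.Binary.PropositionalEquality
  open import Relation.Nullary using (does)

  ι : ℕ → ℚ
  ι k = + k / 1

  private
    ι≡mkℚ : ∀ k → ι k ≡ mkℚ (+ k) 0 (Coprimality.sym (1-coprimeTo k))
    ι≡mkℚ k = ℚP.normalize-coprime (Coprimality.sym (1-coprimeTo k))

  ι-+ : ∀ k l → ι (k ℕ.+ l) ≡ ι k + ι l
  ι-+ k l rewrite ι≡mkℚ k | ι≡mkℚ l =
    cong₂ (λ a b → (a ℤ.+ b) / 1) (sym (ℤP.*-identityʳ (+ k))) (sym (ℤP.*-identityʳ (+ l)))

  ι-* : ∀ k l → ι (k ℕ.* l) ≡ ι k * ι l
  ι-* k l rewrite ι≡mkℚ k | ι≡mkℚ l = cong (_/ 1) (ℤP.pos-* k l)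

  ι-mono : ∀ {k l} → k ℕ.≤ l → ι k ≤ ι l
  ι-mono {k} {l} k≤l rewrite ι≡mkℚ k | ι≡mkℚ l = ℚ.*≤* (ℤP.*-monoʳ-≤-nonNeg (+ 1) (ℤ.+≤+ k≤l))

  ι-nonneg : ∀ k → 0ℚ ≤ ι k
  ι-nonneg k = ι-mono {0} {k} ℕ.z≤n

  /-*-ι : ∀ a d .{{_ : NonZero d}} → (+ a / d) * ι d ≡ ι a
  /-*-ι a (suc d) = ℚP.toℚᵘ-injective (begin-equality
      ℚ.toℚᵘ ((+ a / suc d) * ι (suc d))              ≃⟨ ℚP.toℚᵘ-homo-* (+ a / suc d) (ι (suc d)) ⟩
      ℚ.toℚᵘ (+ a / suc d) ℚᵘ.* ℚ.toℚᵘ (ι (suc d))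
        ≃⟨ ℚᵘP.*-cong (ℚP.toℚᵘ-fromℚᵘ (mkℚᵘ (+ a) d)) (ℚP.toℚᵘ-fromℚᵘ (mkℚᵘ (+ suc d) 0)) ⟩
      mkℚᵘ (+ a) d ℚᵘ.* mkℚᵘ (+ suc d) 0              ≃⟨ *≡* (cross (+ a) (+ suc d) (ℤP.pos-* (suc d) 1)) ⟩
      mkℚᵘ (+ a) 0                                    ≃⟨ ℚP.toℚᵘ-fromℚᵘ (mkℚᵘ (+ a) 0) ⟨
      ℚ.toℚᵘ (ι a)                                    ∎)
    where
    open ℚᵘP.≤-Reasoning
    cross : ∀ x y {z} → z ≡ y ℤ.* + 1 → (x ℤ.* y) ℤ.* + 1 ≡ x ℤ.* z
    cross x y refl = ℤP.*-assoc x y (+ 1)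

  Σᴸ : ∀ {A : Set} → (A → ℚ) → List A → ℚ
  Σᴸ f xs = foldr _+_ 0ℚ (map f xs)

  module _ {A : Set} where

    Σᴸ-cong : ∀ {f g : A → ℚ} xs → (∀ x → f x ≡ g x) → Σᴸ f xs ≡ Σᴸ g xs
    Σᴸ-cong []       f≗g = refl
    Σᴸ-cong (x ∷ xs) f≗g = cong₂ _+_ (f≗g x) (Σᴸ-cong xs f≗g)

    Σᴸ-+ : ∀ (f g : A → ℚ) xs → Σᴸ (λ x → f x + g x) xs ≡ Σᴸ f xs + Σᴸ g xs
    Σᴸ-+ f g []       = refl
    Σᴸ-+ f g (x ∷ xs) = trans (cong (λ r → f x + g x + r) (Σᴸ-+ f g xs)) (interchange (f x) (g x) (Σᴸ f xs) (Σᴸ g xs))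

    Σᴸ-*ˡ : ∀ c (f : A → ℚ) xs → Σᴸ (λ x → c * f x) xs ≡ c * Σᴸ f xs
    Σᴸ-*ˡ c f []       = sym (ℚP.*-zeroʳ c)
    Σᴸ-*ˡ c f (x ∷ xs) = trans (cong (λ r → c * f x + r) (Σᴸ-*ˡ c f xs)) (sym (ℚP.*-distribˡ-+ c (f x) (Σᴸ f xs)))

    Σᴸ-*ʳ : ∀ c (f : A → ℚ) xs → Σᴸ (λ x → f x * c) xs ≡ Σᴸ f xs * c
    Σᴸ-*ʳ c f xs = trans (Σᴸ-cong xs (λ x → ℚP.*-comm (f x) c)) (trans (Σᴸ-*ˡ c f xs) (ℚP.*-comm c (Σᴸ f xs)))

    Σᴸ-mono : ∀ {f g : A → ℚ} {xs} → All (λ x → f x ≤ g x) xs → Σᴸ f xs ≤ Σᴸ g xs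
    Σᴸ-mono []         = ℚP.≤-refl
    Σᴸ-mono (fx≤gx ∷ rest) = ℚP.+-mono-≤ fx≤gx (Σᴸ-mono rest)

  Σᴸ-nonneg : ∀ {A : Set} {f : A → ℚ} {xs} → All (λ x → 0ℚ ≤ f x) xs → 0ℚ ≤ Σᴸ f xs
  Σᴸ-nonneg []             = ℚP.≤-refl
  Σᴸ-nonneg (0≤fx ∷ 0≤Σ) = ℚP.+-mono-≤ 0≤fx (Σᴸ-nonneg 0≤Σ)

  ι-sum : ∀ {A : Set} {N} (g : Fin N → A) (f : A → ℕ) → ι (∑[ i < N ] f (g i)) ≡ Σᴸ (ι ∘ f) (tabulate g)
  ι-sum {N = zero}  g f = refl
  ι-sum {N = suc N} g f = trans (ι-+ (f (g Fin.zero)) _) (cong (λ r → ι (f (g Fin.zero)) + r) (ι-sum (g ∘ Fin.suc) f))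

  ∑ᶜ : ∀ q → (Vec (Fin 3) q → ℚ) → ℚ
  ∑ᶜ zero    f = f []
  ∑ᶜ (suc q) f = ∑ᶜ q (f ∘ (0F ∷_)) + ∑ᶜ q (f ∘ (1F ∷_)) + ∑ᶜ q (f ∘ (2F ∷_))

  ∑ᶜ-cong : ∀ q {f g : Vec (Fin 3) q → ℚ} → (∀ δ → f δ ≡ g δ) → ∑ᶜ q f ≡ ∑ᶜ q g
  ∑ᶜ-cong zero    f≗g = f≗g []
  ∑ᶜ-cong (suc q) f≗g =
    cong₂ _+_ (cong₂ _+_ (∑ᶜ-cong q (f≗g ∘ (0F ∷_))) (∑ᶜ-cong q (f≗g ∘ (1F ∷_)))) (∑ᶜ-cong q (f≗g ∘ (2F ∷_)))

  ∑ᶜ-zero : ∀ q → ∑ᶜ q (λ _ → 0ℚ) ≡ 0ℚ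
  ∑ᶜ-zero zero    = refl
  ∑ᶜ-zero (suc q) = cong₂ _+_ (cong₂ _+_ (∑ᶜ-zero q) (∑ᶜ-zero q)) (∑ᶜ-zero q)

  ∑ᶜ-+ : ∀ q (f g : Vec (Fin 3) q → ℚ) → ∑ᶜ q (λ δ → f δ + g δ) ≡ ∑ᶜ q f + ∑ᶜ q g
  ∑ᶜ-+ zero    f g = refl
  ∑ᶜ-+ (suc q) f g = begin
    ∑ᶜ q (λ δ → f (0F ∷ δ) + g (0F ∷ δ)) + ∑ᶜ q (λ δ → f (1F ∷ δ) + g (1F ∷ δ)) + ∑ᶜ q (λ δ → f (2F ∷ δ) + g (2F ∷ δ))
      ≡⟨ cong₂ _+_ (cong₂ _+_ (∑ᶜ-+ q _ _) (∑ᶜ-+ q _ _)) (∑ᶜ-+ q _ _) ⟩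
    (F₀ + G₀) + (F₁ + G₁) + (F₂ + G₂)   ≡⟨ cong (_+ (F₂ + G₂)) (interchange F₀ G₀ F₁ G₁) ⟩
    (F₀ + F₁) + (G₀ + G₁) + (F₂ + G₂)   ≡⟨ interchange (F₀ + F₁) (G₀ + G₁) F₂ G₂ ⟩
    (F₀ + F₁ + F₂) + (G₀ + G₁ + G₂)     ∎
    where
    open ≡-Reasoning
    F₀ = ∑ᶜ q (f ∘ (0F ∷_))
    F₁ = ∑ᶜ q (f ∘ (1F ∷_))
    F₂ = ∑ᶜ q (f ∘ (2F ∷_))
    G₀ = ∑ᶜ q (g ∘ (0F ∷_))
    G₁ = ∑ᶜ q (g ∘ (1F ∷_))
    G₂ = ∑ᶜ q (g ∘ (2F ∷_))

  ∑ᶜ-*ˡ : ∀ q c (f : Vec (Fin 3) q → ℚ) → ∑ᶜ q (λ δ → c * f δ) ≡ c * ∑ᶜ q f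
  ∑ᶜ-*ˡ zero    c f = refl
  ∑ᶜ-*ˡ (suc q) c f = trans (cong₂ _+_ (cong₂ _+_ (∑ᶜ-*ˡ q c _) (∑ᶜ-*ˡ q c _)) (∑ᶜ-*ˡ q c _))
    (trans (cong (_+ c * ∑ᶜ q (f ∘ (2F ∷_))) (sym (ℚP.*-distribˡ-+ c _ _))) (sym (ℚP.*-distribˡ-+ c _ _)))

  ∑ᶜ-Σᴸ : ∀ {A : Set} q (f : A → Vec (Fin 3) q → ℚ) xs → ∑ᶜ q (λ δ → Σᴸ (λ x → f x δ) xs) ≡ Σᴸ (λ x → ∑ᶜ q (f x)) xs
  ∑ᶜ-Σᴸ q f []       = ∑ᶜ-zero q
  ∑ᶜ-Σᴸ q f (x ∷ xs) = trans (∑ᶜ-+ q (f x) _) (cong (λ r → ∑ᶜ q (f x) + r) (∑ᶜ-Σᴸ q f xs))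

  private
    absent : ∀ q (g : Vec (Fin 3) q → ℚ) → ∑ᶜ q (λ δ → ι 0 * g δ) ≡ 0ℚ
    absent q g = trans (∑ᶜ-cong q (λ δ → ℚP.*-zeroˡ (g δ))) (∑ᶜ-zero q)

  ∑ᶜ-δ : ∀ {q} (x : Vec (Fin 3) q) (g : Vec (Fin 3) q → ℚ) → ∑ᶜ q (λ δ → ι (𝟙 (does (x ≟ᵛ δ))) * g δ) ≡ g x
  ∑ᶜ-δ []       g = ℚP.*-identityˡ (g [])
  ∑ᶜ-δ {suc q} (0F ∷ x) g = begin
    ∑ᶜ q (λ δ → ι (𝟙 (does (x ≟ᵛ δ))) * g (0F ∷ δ)) + ∑ᶜ q (λ δ → ι 0 * g (1F ∷ δ)) + ∑ᶜ q (λ δ → ι 0 * g (2F ∷ δ))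
      ≡⟨ cong₂ _+_ (cong₂ _+_ (∑ᶜ-δ x (g ∘ (0F ∷_))) (absent q (g ∘ (1F ∷_)))) (absent q (g ∘ (2F ∷_))) ⟩
    g (0F ∷ x) + 0ℚ + 0ℚ
      ≡⟨ trans (ℚP.+-identityʳ _) (ℚP.+-identityʳ _) ⟩
    g (0F ∷ x) ∎
    where open ≡-Reasoning
  ∑ᶜ-δ {suc q} (1F ∷ x) g = begin
    ∑ᶜ q (λ δ → ι 0 * g (0F ∷ δ)) + ∑ᶜ q (λ δ → ι (𝟙 (does (x ≟ᵛ δ))) * g (1F ∷ δ)) + ∑ᶜ q (λ δ → ι 0 * g (2F ∷ δ))
      ≡⟨ cong₂ _+_ (cong₂ _+_ (absent q (g ∘ (0F ∷_))) (∑ᶜ-δ x (g ∘ (1F ∷_)))) (absent q (g ∘ (2F ∷_))) ⟩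
    0ℚ + g (1F ∷ x) + 0ℚ
      ≡⟨ trans (ℚP.+-identityʳ _) (ℚP.+-identityˡ _) ⟩
    g (1F ∷ x) ∎
    where open ≡-Reasoning
  ∑ᶜ-δ {suc q} (2F ∷ x) g = begin
    ∑ᶜ q (λ δ → ι 0 * g (0F ∷ δ)) + ∑ᶜ q (λ δ → ι 0 * g (1F ∷ δ)) + ∑ᶜ q (λ δ → ι (𝟙 (does (x ≟ᵛ δ))) * g (2F ∷ δ))
      ≡⟨ cong₂ _+_ (cong₂ _+_ (absent q (g ∘ (0F ∷_))) (absent q (g ∘ (1F ∷_)))) (∑ᶜ-δ x (g ∘ (2F ∷_))) ⟩
    0ℚ + 0ℚ + g (2F ∷ x)
      ≡⟨ ℚP.+-identityˡ _ ⟩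
    g (2F ∷ x) ∎
    where open ≡-Reasoning

  square-nonneg : ∀ x → 0ℚ ≤ x * x
  square-nonneg x with ℚP.≤-total 0ℚ x
  ... | inj₁ 0≤x = ℚP.nonNegative⁻¹ (x * x) {{ℚP.nonNeg*nonNeg⇒nonNeg x {{ℚ.nonNegative 0≤x}} x {{ℚ.nonNegative 0≤x}}}}
  ... | inj₂ x≤0 = ℚP.nonNegative⁻¹ (x * x) {{ℚP.nonPos*nonPos⇒nonPos x {{ℚ.nonPositive x≤0}} x {{ℚ.nonPositive x≤0}}}}

  ∑ᶜ-square : ∀ q (R : Vec (Fin 3) q → ℚ) → ∑ᶜ q R * ∑ᶜ q R ≤ ι (3 ℕ.^ q) * ∑ᶜ q (λ δ → R δ * R δ)
  ∑ᶜ-square zero    R = ℚP.≤-reflexive (sym (ℚP.*-identityˡ (R [] * R [])))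
  ∑ᶜ-square (suc q) R = begin
    (S₀ + S₁ + S₂) * (S₀ + S₁ + S₂)
      ≤⟨ ℚP.≤-trans (ℚP.≤-reflexive (sym (ℚP.+-identityʳ S²))) (ℚP.+-monoʳ-≤ S² spread≥0) ⟩
    (S₀ + S₁ + S₂) * (S₀ + S₁ + S₂) + ((S₀ - S₁) * (S₀ - S₁) + (S₁ - S₂) * (S₁ - S₂) + (S₀ - S₂) * (S₀ - S₂))
      ≡⟨ lagrange S₀ S₁ S₂ ⟩
    ι 3 * (S₀ * S₀ + S₁ * S₁ + S₂ * S₂)
      ≤⟨ ℚP.*-monoˡ-≤-nonNeg (ι 3) {{ℚ.nonNegative (ι-nonneg 3)}}
           (ℚP.+-mono-≤ (ℚP.+-mono-≤ (∑ᶜ-square q (R ∘ (0F ∷_))) (∑ᶜ-square q (R ∘ (1F ∷_)))) (∑ᶜ-square q (R ∘ (2F ∷_)))) ⟩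
    ι 3 * (t * Q₀ + t * Q₁ + t * Q₂)
      ≡⟨ regroup (ι 3) t Q₀ Q₁ Q₂ ⟩
    (ι 3 * t) * (Q₀ + Q₁ + Q₂)
      ≡⟨ cong (_* (Q₀ + Q₁ + Q₂)) (sym (ι-* 3 (3 ℕ.^ q))) ⟩
    ι (3 ℕ.^ suc q) * ∑ᶜ (suc q) (λ δ → R δ * R δ) ∎
    where
    open ℚP.≤-Reasoning
    open +-*-Solver
    S₀ = ∑ᶜ q (R ∘ (0F ∷_))
    S₁ = ∑ᶜ q (R ∘ (1F ∷_))
    S₂ = ∑ᶜ q (R ∘ (2F ∷_))
    Q₀ = ∑ᶜ q (λ δ → R (0F ∷ δ) * R (0F ∷ δ))
    Q₁ = ∑ᶜ q (λ δ → R (1F ∷ δ) * R (1F ∷ δ))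
    Q₂ = ∑ᶜ q (λ δ → R (2F ∷ δ) * R (2F ∷ δ))
    t = ι (3 ℕ.^ q)
    S² = (S₀ + S₁ + S₂) * (S₀ + S₁ + S₂)
    spread≥0 : 0ℚ ≤ (S₀ - S₁) * (S₀ - S₁) + (S₁ - S₂) * (S₁ - S₂) + (S₀ - S₂) * (S₀ - S₂)
    spread≥0 = ℚP.+-mono-≤ (ℚP.+-mono-≤ (square-nonneg (S₀ - S₁)) (square-nonneg (S₁ - S₂))) (square-nonneg (S₀ - S₂))
    lagrange : ∀ a b c → (a + b + c) * (a + b + c) + ((a - b) * (a - b) + (b - c) * (b - c) + (a - c) * (a - c)) ≡
                         ι 3 * (a * a + b * b + c * c)
    lagrange = solve 3 (λ a b c → (a :+ b :+ c) :* (a :+ b :+ c)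
                                  :+ ((a :- b) :* (a :- b) :+ (b :- c) :* (b :- c) :+ (a :- c) :* (a :- c))
                                := con (ι 3) :* (a :* a :+ b :* b :+ c :* c)) refl
    regroup : ∀ k t a b c → k * (t * a + t * b + t * c) ≡ (k * t) * (a + b + c)
    regroup = solve 5 (λ k t a b c → k :* (t :* a :+ t :* b :+ t :* c) := (k :* t) :* (a :+ b :+ c)) refl

  module _ (m : ℕ) .{{_ : NonZero m}} (T : ℕ) where
    open Blocks m T

    private
      ι-occupancy : ∀ F δ → ι (occupancy F δ) ≡ Σᴸ (λ ρ → ι (𝟙 (does (itinerary F ρ ≟ᵛ δ)))) (allFin m)
      ι-occupancy F δ = ι-sum {N = m} id (λ ρ → 𝟙 (does (itinerary F ρ ≟ᵛ δ)))

    ∑ᶜ-occupancy : ∀ F → ∑ᶜ q (λ δ → ι (occupancy F δ)) ≡ ι m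
    ∑ᶜ-occupancy F = begin
      ∑ᶜ q (λ δ → ι (occupancy F δ))                                          ≡⟨ ∑ᶜ-cong q (ι-occupancy F) ⟩
      ∑ᶜ q (λ δ → Σᴸ (λ ρ → ι (𝟙 (does (itinerary F ρ ≟ᵛ δ)))) (allFin m))    ≡⟨ ∑ᶜ-Σᴸ q _ (allFin m) ⟩
      Σᴸ (λ ρ → ∑ᶜ q (λ δ → ι (𝟙 (does (itinerary F ρ ≟ᵛ δ))))) (allFin m)
        ≡⟨ Σᴸ-cong (allFin m) (λ ρ → trans (∑ᶜ-cong q (λ δ → sym (ℚP.*-identityʳ _))) (∑ᶜ-δ (itinerary F ρ) (λ _ → 1ℚ))) ⟩
      Σᴸ (λ ρ → ι 1) (allFin m)                                               ≡⟨ ι-sum {N = m} id (λ _ → 1) ⟨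
      ι (∑[ ρ < m ] 1)                                                        ≡⟨ cong ι (sum-const m 1) ⟩
      ι (m ℕ.* 1)                                                             ≡⟨ cong ι (ℕP.*-identityʳ m) ⟩
      ι m                                                                     ∎
      where open ≡-Reasoning

    ∑ᶜ-collisions : ∀ F G → ∑ᶜ q (λ δ → ι (occupancy F δ) * ι (occupancy G δ)) ≡ ι (collisions F G)
    ∑ᶜ-collisions F G = begin
      ∑ᶜ q (λ δ → ι (occupancy F δ) * ι (occupancy G δ))
        ≡⟨ ∑ᶜ-cong q (λ δ → trans (cong (_* ι (occupancy G δ)) (ι-occupancy F δ)) (sym (Σᴸ-*ʳ _ _ (allFin m)))) ⟩
      ∑ᶜ q (λ δ → Σᴸ (λ ρ → ι (𝟙 (does (itinerary F ρ ≟ᵛ δ))) * ι (occupancy G δ)) (allFin m))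
        ≡⟨ ∑ᶜ-Σᴸ q _ (allFin m) ⟩
      Σᴸ (λ ρ → ∑ᶜ q (λ δ → ι (𝟙 (does (itinerary F ρ ≟ᵛ δ))) * ι (occupancy G δ))) (allFin m)
        ≡⟨ Σᴸ-cong (allFin m) (λ ρ → ∑ᶜ-δ (itinerary F ρ) (λ δ → ι (occupancy G δ))) ⟩
      Σᴸ (λ ρ → ι (occupancy G (itinerary F ρ))) (allFin m)
        ≡⟨ ι-sum {N = m} id (λ ρ → occupancy G (itinerary F ρ)) ⟨
      ι (collisions F G) ∎
      where open ≡-Reasoning

  ^ℚ-ι : ∀ a k → ι a ^ℚ k ≡ ι (a ℕ.^ k)
  ^ℚ-ι a zero    = refl
  ^ℚ-ι a (suc k) = trans (cong (ι a *_) (^ℚ-ι a k)) (sym (ι-* a (a ℕ.^ k)))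

  ^ℚ-distrib-* : ∀ x y k → (x * y) ^ℚ k ≡ x ^ℚ k * y ^ℚ k
  ^ℚ-distrib-* x y zero    = refl
  ^ℚ-distrib-* x y (suc k) = trans (cong ((x * y) *_) (^ℚ-distrib-* x y k)) (interchange* x y (x ^ℚ k) (y ^ℚ k))
    where
    open +-*-Solver
    interchange* : ∀ a b c d → (a * b) * (c * d) ≡ (a * c) * (b * d)
    interchange* = solve 4 (λ a b c d → (a :* b) :* (c :* d) := (a :* c) :* (b :* d)) refl

  nonneg-* : ∀ {x y} → 0ℚ ≤ x → 0ℚ ≤ y → 0ℚ ≤ x * y
  nonneg-* {x} {y} 0≤x 0≤y =
    ℚP.nonNegative⁻¹ (x * y) {{ℚP.nonNeg*nonNeg⇒nonNeg x {{ℚ.nonNegative 0≤x}} y {{ℚ.nonNegative 0≤y}}}}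

  *-monoˡ-≤ : ∀ {c x y} → 0ℚ ≤ c → x ≤ y → c * x ≤ c * y
  *-monoˡ-≤ {c} 0≤c = ℚP.*-monoˡ-≤-nonNeg c {{ℚ.nonNegative 0≤c}}

  ^ℚ-nonneg : ∀ {x} k → 0ℚ ≤ x → 0ℚ ≤ x ^ℚ k
  ^ℚ-nonneg zero    _   = ι-nonneg 1
  ^ℚ-nonneg (suc k) 0≤x = nonneg-* 0≤x (^ℚ-nonneg k 0≤x)

  1≤^ℚ : ∀ {x} k → 1ℚ ≤ x → 1ℚ ≤ x ^ℚ k
  1≤^ℚ zero    _   = ℚP.≤-refl
  1≤^ℚ {x} (suc k) 1≤x = begin
    1ℚ              ≤⟨ 1≤x ⟩
    x               ≡⟨ ℚP.*-identityʳ x ⟨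
    x * 1ℚ          ≤⟨ *-monoˡ-≤ (ℚP.≤-trans (ι-nonneg 1) 1≤x) (1≤^ℚ k 1≤x) ⟩
    x * x ^ℚ k      ∎
    where open ℚP.≤-Reasoning

open import Defs
open import Data.Nat using (ℕ; NonZero)
open import Data.Nat.DivMod using () renaming (_/_ to _div_)
open import Data.Nat.Divisibility using (_∣_)
open import Data.Integer using (+_)
open import Data.Rational using (ℚ; 1ℚ; _≤_; _*_; _/_)
open Integers
open Counting
open Walks
open Itineraries
open RationalSums
open import Data.Bool using (Bool; true; false; not)
open import Data.Fin using (Fin; toℕ)
open import Data.Integer using (ℤ; _+_; _-_; -_)
open import Data.Integer.Tactic.RingSolver using (solve-∀)
open import Data.List.Relation.Unary.All as All using ()
open import Data.Nat as ℕ using (suc)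
import Data.Nat.DivMod as ℕD
import Data.Nat.Properties as ℕP
import Data.Nat.Tactic.RingSolver as ℕ-Solver
open import Data.Product using (_×_; _,_; proj₁; proj₂)
open import Data.Rational as ℚ using (0ℚ)
import Data.Rational.Properties as ℚP
open import Data.Rational.Solver using (module +-*-Solver)
open import Data.Vec using (Vec)
open import Function using (id)
open import Relation.Binary.PropositionalEquality hiding ([_])

module Rendezvous (n m : ℕ) .{{_ : NonZero n}} .{{_ : NonZero m}} (n≡6m : n ≡ 6 ℕ.* m) (T : ℕ) where

  open Blocks m T

  private
    3≤n : 3 ℕ.≤ n
    3≤n = subst (3 ℕ.≤_) (sym n≡6m) (ℕP.≤-trans (ℕP.m≤m+n 3 3) (ℕP.*-monoʳ-≤ 6 (ℕ.>-nonZero⁻¹ m)))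

    4m≤n : 4 ℕ.* m ℕ.≤ n
    4m≤n = subst (4 ℕ.* m ℕ.≤_) (sym n≡6m) (ℕP.*-monoˡ-≤ m (ℕP.m≤m+n 4 2))

  open Cycle n

  lift : Walk n T → ℕ → ℤ
  lift u = proj₁ (walk-lift (proj₁ u) (proj₂ u))

  lift-lifts : ∀ u → Lifts (lift u) (proj₁ u)
  lift-lifts u = proj₁ (proj₂ (walk-lift (proj₁ u) (proj₂ u)))

  lift-lipschitz : ∀ u → Lipschitz (lift u)
  lift-lipschitz u = proj₂ (proj₂ (walk-lift (proj₁ u) (proj₂ u)))

  image : Bool → Walk n T → Fin n → Vec (Fin n) (suc T)
  image ε b s = mapVec n (applyAut n (s , ε)) (proj₁ b)

  rotation-lifts : ∀ b s → Lifts (λ t → lift b t + + toℕ s) (image false b s)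
  rotation-lifts b s = Lifts-map {f = applyAut n (s , false)} {g = λ z → z + + toℕ s}
    (λ z → trans (cong (_⊕_ n [ z ]) (sym ([]-toℕ s))) (⊕-[] z (+ toℕ s))) (proj₁ b) (lift-lifts b)

  reflection-lifts : ∀ b s → Lifts (λ t → negate (lift b) t + + toℕ s) (image true b s)
  reflection-lifts b s = Lifts-map {f = applyAut n (s , true)} {g = λ z → - z + + toℕ s}
    (λ z → trans (cong₂ (_⊕_ n) (⊝-[] z) (sym ([]-toℕ s))) (⊕-[] (- z) (+ toℕ s))) (proj₁ b) (lift-lifts b)

  noMeetCount-split : ∀ a b →
    noMeetCount n a b ≡ good-shifts (proj₁ a) (image true b) ℕ.+ good-shifts (proj₁ a) (image false b)
  noMeetCount-split a b = count-pairs id (λ π → not (meets n (proj₁ a) (mapVec n (applyAut n π) (proj₁ b))))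

  rotation-window : ∀ a b {P w} → w ℕ.≤ 4 ℕ.* m → InWindow T (λ t → lift a t - lift b t) P w →
                    6 ℕ.* m ℕ.≤ good-shifts (proj₁ a) (image false b) ℕ.+ w
  rotation-window a b w≤4m window = subst (ℕ._≤ good-shifts (proj₁ a) (image false b) ℕ.+ _) n≡6m
    (window⇒good 3≤n (ℕP.≤-trans w≤4m 4m≤n) (lift-lifts a) (rotation-lifts b) (lift-lipschitz a) (lift-lipschitz b) window)

  reflection-window : ∀ a b {P w} → w ℕ.≤ 4 ℕ.* m → InWindow T (λ t → lift a t - negate (lift b) t) P w →
                      6 ℕ.* m ℕ.≤ good-shifts (proj₁ a) (image true b) ℕ.+ w
  reflection-window a b w≤4m window = subst (ℕ._≤ good-shifts (proj₁ a) (image true b) ℕ.+ _) n≡6m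
    (window⇒good 3≤n (ℕP.≤-trans w≤4m 4m≤n) (lift-lifts a) (reflection-lifts b) (lift-lipschitz a)
                 (Lipschitz-negate (lift-lipschitz b)) window)

  collisionSum : Walk n T → Walk n T → ℕ
  collisionSum a b =
    collisions Fa Fb ℕ.+ collisions Fa (negate Fb) ℕ.+ collisions (negate Fa) Fb ℕ.+ collisions (negate Fa) (negate Fb)
    where
    Fa = lift a
    Fb = lift b

  pair-bound : ∀ a b → 3 ℕ.* collisionSum a b ℕ.≤ (m ℕ.+ m) ℕ.* noMeetCount n a b
  pair-bound a b = begin
    3 ℕ.* (c₁ ℕ.+ c₂ ℕ.+ c₃ ℕ.+ c₄)                         ≡⟨ distribute 3 c₁ c₂ c₃ c₄ ⟩
    3 ℕ.* c₁ ℕ.+ 3 ℕ.* c₂ ℕ.+ 3 ℕ.* c₃ ℕ.+ 3 ℕ.* c₄           ≤⟨ ℕP.+-mono-≤ (ℕP.+-mono-≤ (ℕP.+-mono-≤ c₁≤ c₂≤) c₃≤) c₄≤ ⟩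
    m ℕ.* rot ℕ.+ m ℕ.* ref ℕ.+ m ℕ.* ref ℕ.+ m ℕ.* rot       ≡⟨ collect m ref rot ⟩
    (m ℕ.+ m) ℕ.* (ref ℕ.+ rot)                              ≡⟨ cong ((m ℕ.+ m) ℕ.*_) (noMeetCount-split a b) ⟨
    (m ℕ.+ m) ℕ.* noMeetCount n a b                          ∎
    where
    open ℕP.≤-Reasoning
    Fa = lift a
    Fb = lift b
    ref = good-shifts (proj₁ a) (image true b)
    rot = good-shifts (proj₁ a) (image false b)
    c₁ = collisions Fa Fb
    c₂ = collisions Fa (negate Fb)
    c₃ = collisions (negate Fa) Fb
    c₄ = collisions (negate Fa) (negate Fb)
    flip₁ : ∀ a b → a - - b ≡ - (- a - b)
    flip₁ = solve-∀
    flip₂ : ∀ a b → a - b ≡ - (- a - - b)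
    flip₂ = solve-∀
    c₁≤ : 3 ℕ.* c₁ ℕ.≤ m ℕ.* rot
    c₁≤ = collision-bound (lift-lipschitz a) (lift-lipschitz b) (rotation-window a b)
    c₂≤ : 3 ℕ.* c₂ ℕ.≤ m ℕ.* ref
    c₂≤ = collision-bound (lift-lipschitz a) (Lipschitz-negate (lift-lipschitz b)) (reflection-window a b)
    c₃≤ : 3 ℕ.* c₃ ℕ.≤ m ℕ.* ref
    c₃≤ = collision-bound (Lipschitz-negate (lift-lipschitz a)) (lift-lipschitz b)
      (λ w≤4m window → reflection-window a b w≤4m (window-negate (λ t → flip₁ (Fa t) (Fb t)) window))
    c₄≤ : 3 ℕ.* c₄ ℕ.≤ m ℕ.* rot
    c₄≤ = collision-bound (Lipschitz-negate (lift-lipschitz a)) (Lipschitz-negate (lift-lipschitz b))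
      (λ w≤4m window → rotation-window a b w≤4m (window-negate (λ t → flip₂ (Fa t) (Fb t)) window))
    distribute : ∀ k a b c d → k ℕ.* (a ℕ.+ b ℕ.+ c ℕ.+ d) ≡ k ℕ.* a ℕ.+ k ℕ.* b ℕ.+ k ℕ.* c ℕ.+ k ℕ.* d
    distribute = ℕ-Solver.solve-∀
    collect : ∀ m x y → m ℕ.* y ℕ.+ m ℕ.* x ℕ.+ m ℕ.* x ℕ.+ m ℕ.* y ≡ (m ℕ.+ m) ℕ.* (x ℕ.+ y)
    collect = ℕ-Solver.solve-∀

  module _ (σ : Strategy n T) where

    private
      S = Strategy.support σ
      p : Walk n T × ℚ → ℚ
      p = proj₂
      P = probNoRendezvous n σ

      instance
        2n≢0 : NonZero (2 ℕ.* n)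
        2n≢0 = ℕP.m*n≢0 2 n

    Σ² : (Walk n T → Walk n T → ℚ) → ℚ
    Σ² f = Σᴸ (λ a → Σᴸ (λ b → p a * p b * f (proj₁ a) (proj₁ b)) S) S

    Σ²-*ˡ : ∀ c f → Σ² (λ a b → c * f a b) ≡ c * Σ² f
    Σ²-*ˡ c f = trans (Σᴸ-cong S (λ a → trans (Σᴸ-cong S (λ b → swap (p a * p b) c (f (proj₁ a) (proj₁ b)))) (Σᴸ-*ˡ c _ S)))
                      (Σᴸ-*ˡ c _ S)
      where
      swap : ∀ x c y → x * (c * y) ≡ c * (x * y)
      swap x c y = trans (sym (ℚP.*-assoc x c y)) (trans (cong (_* y) (ℚP.*-comm x c)) (ℚP.*-assoc c x y))

    Σ²-mono : ∀ {f g} → (∀ a b → f a b ≤ g a b) → Σ² f ≤ Σ² g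
    Σ²-mono {f} {g} f≤g = Σᴸ-mono (All.map (λ 0≤pa →
      Σᴸ-mono (All.map (λ 0≤pb → *-monoˡ-≤ (nonneg-* 0≤pa 0≤pb) (f≤g _ _)) (Strategy.nonneg σ))) (Strategy.nonneg σ))

    P-rescaled : P * ι (2 ℕ.* n) ≡ Σ² (λ a b → ι (noMeetCount n a b))
    P-rescaled = trans (sym (Σᴸ-*ʳ (ι (2 ℕ.* n)) _ S)) (Σᴸ-cong S (λ a → trans (sym (Σᴸ-*ʳ (ι (2 ℕ.* n)) _ S))
      (Σᴸ-cong S (λ b → trans (ℚP.*-assoc (p a * p b) _ (ι (2 ℕ.* n)))
                              (cong (p a * p b *_) (/-*-ι (noMeetCount n (proj₁ a) (proj₁ b)) (2 ℕ.* n)))))))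

    P-nonneg : 0ℚ ≤ P
    P-nonneg = Σᴸ-nonneg (All.map (λ {a} 0≤pa → Σᴸ-nonneg (All.map (λ {b} 0≤pb →
                   nonneg-* (nonneg-* 0≤pa 0≤pb) (ratio-nonneg (noMeetCount n (proj₁ a) (proj₁ b))))
                                                               (Strategy.nonneg σ))) (Strategy.nonneg σ))
      where
      ratio-nonneg : ∀ k → 0ℚ ≤ + k / (2 ℕ.* n)
      ratio-nonneg k = ℚP.nonNegative⁻¹ _ {{ℚP.normalize-nonNeg k (2 ℕ.* n)}}

    occupancy± : Walk n T → Vec (Fin 3) q → ℚ
    occupancy± u δ = ι (occupancy (lift u) δ) ℚ.+ ι (occupancy (negate (lift u)) δ)

    ∑ᶜ-occupancy± : ∀ u → ∑ᶜ q (occupancy± u) ≡ ι (m ℕ.+ m)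
    ∑ᶜ-occupancy± u = trans (∑ᶜ-+ q _ _)
      (trans (cong₂ ℚ._+_ (∑ᶜ-occupancy m T (lift u)) (∑ᶜ-occupancy m T (negate (lift u)))) (sym (ι-+ m m)))

    ∑ᶜ-occupancy±² : ∀ a b → ∑ᶜ q (λ δ → occupancy± a δ * occupancy± b δ) ≡ ι (collisionSum a b)
    ∑ᶜ-occupancy±² a b = begin
      ∑ᶜ q (λ δ → occupancy± a δ * occupancy± b δ)
        ≡⟨ ∑ᶜ-cong q (λ δ → expand (A δ) (B δ) (C δ) (D δ)) ⟩
      ∑ᶜ q (λ δ → AC δ ℚ.+ AD δ ℚ.+ BC δ ℚ.+ BD δ)
        ≡⟨ trans (∑ᶜ-+ q (λ δ → AC δ ℚ.+ AD δ ℚ.+ BC δ) BD) (cong (ℚ._+ ∑ᶜ q BD)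
             (trans (∑ᶜ-+ q (λ δ → AC δ ℚ.+ AD δ) BC) (cong (ℚ._+ ∑ᶜ q BC) (∑ᶜ-+ q AC AD)))) ⟩
      ∑ᶜ q AC ℚ.+ ∑ᶜ q AD ℚ.+ ∑ᶜ q BC ℚ.+ ∑ᶜ q BD
        ≡⟨ cong₂ ℚ._+_ (cong₂ ℚ._+_ (cong₂ ℚ._+_ (∑ᶜ-collisions m T Fa Fb) (∑ᶜ-collisions m T Fa (negate Fb)))
                                      (∑ᶜ-collisions m T (negate Fa) Fb)) (∑ᶜ-collisions m T (negate Fa) (negate Fb)) ⟩
      ι c₁ ℚ.+ ι c₂ ℚ.+ ι c₃ ℚ.+ ι c₄
        ≡⟨ trans (ι-+ (c₁ ℕ.+ c₂ ℕ.+ c₃) c₄)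
                 (cong (ℚ._+ ι c₄) (trans (ι-+ (c₁ ℕ.+ c₂) c₃) (cong (ℚ._+ ι c₃) (ι-+ c₁ c₂)))) ⟨
      ι (collisionSum a b) ∎
      where
      open ≡-Reasoning
      open +-*-Solver
      Fa = lift a
      Fb = lift b
      A = λ δ → ι (occupancy Fa δ)
      B = λ δ → ι (occupancy (negate Fa) δ)
      C = λ δ → ι (occupancy Fb δ)
      D = λ δ → ι (occupancy (negate Fb) δ)
      AC = λ δ → A δ * C δ
      AD = λ δ → A δ * D δ
      BC = λ δ → B δ * C δ
      BD = λ δ → B δ * D δ
      c₁ = collisions Fa Fb
      c₂ = collisions Fa (negate Fb)
      c₃ = collisions (negate Fa) Fb
      c₄ = collisions (negate Fa) (negate Fb)
      expand : ∀ a b c d → (a ℚ.+ b) * (c ℚ.+ d) ≡ a * c ℚ.+ a * d ℚ.+ b * c ℚ.+ b * d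
      expand = solve 4 (λ a b c d → (a :+ b) :* (c :+ d) := a :* c :+ a :* d :+ b :* c :+ b :* d) refl

    profile : Vec (Fin 3) q → ℚ
    profile δ = Σᴸ (λ a → p a * occupancy± (proj₁ a) δ) S

    ∑ᶜ-profile : ∑ᶜ q profile ≡ ι (m ℕ.+ m)
    ∑ᶜ-profile = begin
      ∑ᶜ q profile                                   ≡⟨ ∑ᶜ-Σᴸ q (λ a δ → p a * occupancy± (proj₁ a) δ) S ⟩
      Σᴸ (λ a → ∑ᶜ q (λ δ → p a * occupancy± (proj₁ a) δ)) S
        ≡⟨ Σᴸ-cong S (λ a → trans (∑ᶜ-*ˡ q (p a) (occupancy± (proj₁ a))) (cong (p a *_) (∑ᶜ-occupancy± (proj₁ a)))) ⟩
      Σᴸ (λ a → p a * ι (m ℕ.+ m)) S                 ≡⟨ Σᴸ-*ʳ (ι (m ℕ.+ m)) p S ⟩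
      Σᴸ p S * ι (m ℕ.+ m)                           ≡⟨ cong (_* ι (m ℕ.+ m)) (Strategy.total σ) ⟩
      1ℚ * ι (m ℕ.+ m)                               ≡⟨ ℚP.*-identityˡ _ ⟩
      ι (m ℕ.+ m)                                    ∎
      where open ≡-Reasoning

    ∑ᶜ-profile² : ∑ᶜ q (λ δ → profile δ * profile δ) ≡ Σ² (λ a b → ∑ᶜ q (λ δ → occupancy± a δ * occupancy± b δ))
    ∑ᶜ-profile² = begin
      ∑ᶜ q (λ δ → profile δ * profile δ)
        ≡⟨ ∑ᶜ-cong q square ⟩
      ∑ᶜ q (λ δ → Σᴸ (λ a → Σᴸ (λ b → p a * p b * (occupancy± (proj₁ a) δ * occupancy± (proj₁ b) δ)) S) S)
        ≡⟨ ∑ᶜ-Σᴸ q _ S ⟩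
      Σᴸ (λ a → ∑ᶜ q (λ δ → Σᴸ (λ b → p a * p b * (occupancy± (proj₁ a) δ * occupancy± (proj₁ b) δ)) S)) S
        ≡⟨ Σᴸ-cong S (λ a → trans (∑ᶜ-Σᴸ q _ S) (Σᴸ-cong S (λ b → ∑ᶜ-*ˡ q (p a * p b) _))) ⟩
      Σ² (λ a b → ∑ᶜ q (λ δ → occupancy± a δ * occupancy± b δ)) ∎
      where
      open ≡-Reasoning
      open +-*-Solver
      regroup : ∀ pa x pb y → pa * x * (pb * y) ≡ pa * pb * (x * y)
      regroup = solve 4 (λ pa x pb y → pa :* x :* (pb :* y) := pa :* pb :* (x :* y)) refl
      square : ∀ δ →
        profile δ * profile δ ≡ Σᴸ (λ a → Σᴸ (λ b → p a * p b * (occupancy± (proj₁ a) δ * occupancy± (proj₁ b) δ)) S) S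
      square δ = trans (sym (Σᴸ-*ʳ (profile δ) _ S)) (Σᴸ-cong S (λ a → trans (sym (Σᴸ-*ˡ (p a * occupancy± (proj₁ a) δ) _ S))
                   (Σᴸ-cong S (λ b → regroup (p a) (occupancy± (proj₁ a) δ) (p b) (occupancy± (proj₁ b) δ)))))

    profile²-bound : ι 3 * ∑ᶜ q (λ δ → profile δ * profile δ) ≤ ι (m ℕ.+ m) * (P * ι (2 ℕ.* n))
    profile²-bound = begin
      ι 3 * ∑ᶜ q (λ δ → profile δ * profile δ)                     ≡⟨ cong (ι 3 *_) ∑ᶜ-profile² ⟩
      ι 3 * Σ² Φ                                                   ≡⟨ Σ²-*ˡ (ι 3) Φ ⟨
      Σ² (λ a b → ι 3 * Φ a b)                                     ≤⟨ Σ²-mono pair ⟩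
      Σ² (λ a b → ι (m ℕ.+ m) * ι (noMeetCount n a b))             ≡⟨ Σ²-*ˡ (ι (m ℕ.+ m)) (λ a b → ι (noMeetCount n a b)) ⟩
      ι (m ℕ.+ m) * Σ² (λ a b → ι (noMeetCount n a b))             ≡⟨ cong (ι (m ℕ.+ m) *_) P-rescaled ⟨
      ι (m ℕ.+ m) * (P * ι (2 ℕ.* n))                              ∎
      where
      open ℚP.≤-Reasoning
      Φ : Walk n T → Walk n T → ℚ
      Φ a b = ∑ᶜ q (λ δ → occupancy± a δ * occupancy± b δ)
      pair : ∀ a b → ι 3 * Φ a b ≤ ι (m ℕ.+ m) * ι (noMeetCount n a b)
      pair a b = begin
        ι 3 * Φ a b                                  ≡⟨ cong (ι 3 *_) (∑ᶜ-occupancy±² a b) ⟩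
        ι 3 * ι (collisionSum a b)                   ≡⟨ ι-* 3 (collisionSum a b) ⟨
        ι (3 ℕ.* collisionSum a b)                   ≤⟨ ι-mono (pair-bound a b) ⟩
        ι ((m ℕ.+ m) ℕ.* noMeetCount n a b)          ≡⟨ ι-* (m ℕ.+ m) (noMeetCount n a b) ⟩
        ι (m ℕ.+ m) * ι (noMeetCount n a b)          ∎

    1≤2P·3^q : 1ℚ ≤ (ι 2 * P) * ι (3 ℕ.^ q)
    1≤2P·3^q = ℚP.*-cancelˡ-≤-pos (ι k) {{ℚP.normalize-pos k 1 {{_}} {{k≢0}}}} (begin
      ι k * 1ℚ                                               ≡⟨ ℚP.*-identityʳ (ι k) ⟩
      ι k                                                    ≡⟨ ι-split ⟩
      ι 3 * (ι (m ℕ.+ m) * ι (m ℕ.+ m))                      ≡⟨ cong (λ s → ι 3 * (s * s)) ∑ᶜ-profile ⟨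
      ι 3 * (∑ᶜ q profile * ∑ᶜ q profile)                    ≤⟨ *-monoˡ-≤ (ι-nonneg 3) (∑ᶜ-square q profile) ⟩
      ι 3 * (ι (3 ℕ.^ q) * ∑ᶜ q (λ δ → profile δ * profile δ))  ≡⟨ swap (ι 3) (ι (3 ℕ.^ q)) _ ⟩
      ι (3 ℕ.^ q) * (ι 3 * ∑ᶜ q (λ δ → profile δ * profile δ))  ≤⟨ *-monoˡ-≤ (ι-nonneg (3 ℕ.^ q)) profile²-bound ⟩
      ι (3 ℕ.^ q) * (ι (m ℕ.+ m) * (P * ι (2 ℕ.* n)))        ≡⟨ rearrange ⟩
      ι k * ((ι 2 * P) * ι (3 ℕ.^ q))                         ∎)
      where
      open ℚP.≤-Reasoning
      open +-*-Solver
      k = 12 ℕ.* (m ℕ.* m)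
      k≢0 : NonZero k
      k≢0 = ℕP.m*n≢0 12 (m ℕ.* m) {{_}} {{ℕP.m*n≢0 m m}}
      ι-split : ι k ≡ ι 3 * (ι (m ℕ.+ m) * ι (m ℕ.+ m))
      ι-split = trans (cong ι (twelve m)) (trans (ι-* 3 ((m ℕ.+ m) ℕ.* (m ℕ.+ m))) (cong (ι 3 *_) (ι-* (m ℕ.+ m) (m ℕ.+ m))))
        where
        twelve : ∀ m → 12 ℕ.* (m ℕ.* m) ≡ 3 ℕ.* ((m ℕ.+ m) ℕ.* (m ℕ.+ m))
        twelve = ℕ-Solver.solve-∀
      swap : ∀ a b c → a * (b * c) ≡ b * (a * c)
      swap = solve 3 (λ a b c → a :* (b :* c) := b :* (a :* c)) refl
      sizes : ι (m ℕ.+ m) * ι (2 ℕ.* n) ≡ ι 2 * ι k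
      sizes = trans (sym (ι-* (m ℕ.+ m) (2 ℕ.* n)))
                    (trans (cong ι (trans (cong (λ n → (m ℕ.+ m) ℕ.* (2 ℕ.* n)) n≡6m) (product m))) (ι-* 2 k))
        where
        product : ∀ m → (m ℕ.+ m) ℕ.* (2 ℕ.* (6 ℕ.* m)) ≡ 2 ℕ.* (12 ℕ.* (m ℕ.* m))
        product = ℕ-Solver.solve-∀
      rearrange : ι (3 ℕ.^ q) * (ι (m ℕ.+ m) * (P * ι (2 ℕ.* n))) ≡ ι k * ((ι 2 * P) * ι (3 ℕ.^ q))
      rearrange = begin-equality
        ι (3 ℕ.^ q) * (ι (m ℕ.+ m) * (P * ι (2 ℕ.* n)))   ≡⟨ pair-up (ι (3 ℕ.^ q)) (ι (m ℕ.+ m)) P (ι (2 ℕ.* n)) ⟩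
        (ι (m ℕ.+ m) * ι (2 ℕ.* n)) * (P * ι (3 ℕ.^ q))   ≡⟨ cong (_* (P * ι (3 ℕ.^ q))) sizes ⟩
        (ι 2 * ι k) * (P * ι (3 ℕ.^ q))                   ≡⟨ pair-down (ι 2) (ι k) P (ι (3 ℕ.^ q)) ⟩
        ι k * ((ι 2 * P) * ι (3 ℕ.^ q))                   ∎
        where
        pair-up : ∀ a b p c → a * (b * (p * c)) ≡ (b * c) * (p * a)
        pair-up = solve 4 (λ a b p c → a :* (b :* (p :* c)) := (b :* c) :* (p :* a)) refl
        pair-down : ∀ d x p a → (d * x) * (p * a) ≡ x * ((d * p) * a)
        pair-down = solve 4 (λ d x p a → (d :* x) :* (p :* a) := x :* ((d :* p) :* a)) refl

    1≤[2P]^m·3^T : 1ℚ ≤ ((ι 2 * P) ^ℚ m) * (ι 3 ^ℚ T)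
    1≤[2P]^m·3^T = begin
      1ℚ                                              ≤⟨ 1≤^ℚ m 1≤2P·3^q ⟩
      ((ι 2 * P) * ι (3 ℕ.^ q)) ^ℚ m                  ≡⟨ ^ℚ-distrib-* (ι 2 * P) (ι (3 ℕ.^ q)) m ⟩
      (ι 2 * P) ^ℚ m * ι (3 ℕ.^ q) ^ℚ m
        ≡⟨ cong ((ι 2 * P) ^ℚ m *_) (trans (^ℚ-ι (3 ℕ.^ q) m) (cong ι (ℕP.^-*-assoc 3 q m))) ⟩
      (ι 2 * P) ^ℚ m * ι (3 ℕ.^ (q ℕ.* m))            ≤⟨ *-monoˡ-≤ (^ℚ-nonneg m (nonneg-* (ι-nonneg 2) P-nonneg))
                                                                   (ι-mono (ℕP.^-monoʳ-≤ 3 (ℕD.m/n*n≤m T m))) ⟩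
      (ι 2 * P) ^ℚ m * ι (3 ℕ.^ T)                    ≡⟨ cong ((ι 2 * P) ^ℚ m *_) (^ℚ-ι 3 T) ⟨
      (ι 2 * P) ^ℚ m * (ι 3 ^ℚ T)                     ∎
      where open ℚP.≤-Reasoning

theorem18 : (n : ℕ) .{{_ : NonZero n}} → 6 ∣ n → (T : ℕ) → (σ : Strategy n T) →
    1ℚ ≤ ((((+ 2 / 1) * probNoRendezvous n σ) ^ℚ (n div 6)) * ((+ 3 / 1) ^ℚ T))
theorem18 n 6∣n T σ = Rendezvous.1≤[2P]^m·3^T n (n div 6) {{_}} {{m≢0}} n≡6m T σ
  where
  n≡6m : n ≡ 6 ℕ.* (n div 6)
  n≡6m = sym (ℕD.m*[n/m]≡n 6∣n)
  m≢0 : NonZero (n div 6)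
  m≢0 = ℕ.≢-nonZero (λ m≡0 → ℕ.≢-nonZero⁻¹ n (trans n≡6m (cong (6 ℕ.*_) m≡0)))
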